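{- If $G\in\mathcal{P}$, then $\chi_i^{c}(G)=7$.
   Context: Incidences and coloring: an incidence of $G$ is a pair $(v,e)$ with $v$ an endpoint of the edge $e$; for a vertex $w$, $I(w)$ is the set of incidences $(u,e)$ with $e$ incident with $w$; two incidences conflict if both lie in some $I(w)$; a conflict-free incidence $k$-coloring assigns colors from a $k$-set to incidences so that conflicting incidences get distinct colors; $\chi^{c}_i(G)$ is the least such $k$. $K_4^+$ is $K_4$ with one edge subdivided once. Configurations (graphs): $G_2$ has vertices $u,v,w,x,y$ and edges $uv,uw,vw,vx,wy$. $G_4$ has vertices $x,y,u_0,u_1,v_0,v_1,w$ and edges $xu_1,u_1u_0,u_1v_0,u_0v_1,u_0w,v_0v_1,v_0w,v_1y$. $G_8$ has vertices $x,y,u_0,u_1,u_2,v_0,v_1$ and edges $xu_2,u_2u_1,u_2v_0,u_1u_0,u_0v_0,u_0v_1,v_0v_1,v_1y$. For $t\geq1$, $H_t$ has vertices $x',y',x_0,\dots,x_t,y_0,\dots,y_t$ and edges $x'y',x'x_0,x'y_0,y'x_0,y'y_0$, $x_{i-1}x_i$ and $y_{i-1}y_i$ for $1\le i\le t$, and $x_iy_i$ for $1\le i\le t-1$. Operations: if $z$ is a vertex of degree 2 of $G$ with neighbors $z_1,z_2$ and $t\in\{2,4,8\}$, $G\sqcup_z G_t$ is obtained by deleting $z$ and adding a disjoint copy of $G_t$ with $x$ identified with $z_1$ and $y$ with $z_2$. If $z_1z_2$ is an edge of $G$ and $t\ge1$, $G\vee_{z_1z_2}H_t$ is obtained by deleting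 the edge $z_1z_2$ and adding a disjoint copy of $H_t$ with $x_t$ identified with $z_1$ and $y_t$ with $z_2$. The class $\mathcal{P}$ is the smallest class of graphs containing $K_4^+$ and closed under these operations. -}

module Defs where

open import Data.Bool using (Bool; true; false; T; not; _∧_; _∨_; if_then_else_)
open import Data.Bool.Properties using (T-irrelevant)
open import Data.Nat using (ℕ; zero; suc; _+_; _∸_; _<_; _≤_; _≡ᵇ_; s≤s)
open import Data.Nat.Properties using (≤-refl; m≤m+n; m≤n⇒m≤1+n)
open import Data.Fin using (Fin; toℕ; fromℕ<; #_)
import Data.Fin as Fin
open import Data.List using (List; []; _∷_; _++_; applyUpTo)
open import Data.Bool.ListAction using (any)
open import Data.Product using (Σ; _×_; _,_; proj₁; proj₂; ∃)
import Data.Product.Properties as ΣP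
open import Data.Sum using (_⊎_; inj₁; inj₂)
import Data.Sum.Properties as ⊎P
open import Relation.Nullary using (¬_; yes; no)
open import Relation.Nullary.Decidable using (⌊_⌋)
open import Relation.Binary.Definitions using (DecidableEquality)
open import Relation.Binary.PropositionalEquality using (_≡_; _≢_; refl)
open import Function.Bundles using (_↔_; Inverse)

-- All concrete graphs built below (and hence all
-- graphs of the class 𝒫) are finite, simple (adjacency symmetric and
-- irreflexive) by construction.

record Graph : Set₁ where
  field
    V   : Set
    _≟_ : DecidableEquality V
    adj : V → V → Bool
open Graph public

record _≅_ (G H : Graph) : Set where
  field
    bij      : V G ↔ V H
    preserve : ∀ a b → adj H (Inverse.to bij a) (Inverse.to bij b) ≡ adj G a b

-- Incidences and conflict-free incidence colourings.
-- An incidence (v , e) with e = vu is represented by the ordered pair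
-- (v , u) together with a proof that vu is an edge.

Incidence : Graph → Set
Incidence G = Σ (V G × V G) λ p → T (adj G (proj₁ p) (proj₂ p))

_∈I_ : {G : Graph} → Incidence G → V G → Set
((v , u) , _) ∈I w = v ≡ w ⊎ u ≡ w

Conflict : (G : Graph) → Incidence G → Incidence G → Set
Conflict G i j = ∃ λ (w : V G) → (_∈I_ {G} i w) × (_∈I_ {G} j w)

IsCFIncColouring : (G : Graph) (k : ℕ) → (Incidence G → Fin k) → Set
IsCFIncColouring G k c =
  ∀ (i j : Incidence G) → proj₁ i ≢ proj₁ j → Conflict G i j → c i ≢ c j

CFIncColourable : Graph → ℕ → Set
CFIncColourable G k = Σ (Incidence G → Fin k) (IsCFIncColouring G k)

χic≡ : Graph → ℕ → Set
χic≡ G n = CFIncColourable G n × (∀ k → k < n → ¬ CFIncColourable G k)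

edgeGraph : (n : ℕ) → List (ℕ × ℕ) → Graph
edgeGraph n es = record
  { V = Fin n
  ; _≟_ = Fin._≟_
  ; adj = λ a b → any (λ e → ((toℕ a ≡ᵇ proj₁ e) ∧ (toℕ b ≡ᵇ proj₂ e))
                            ∨ ((toℕ a ≡ᵇ proj₂ e) ∧ (toℕ b ≡ᵇ proj₁ e))) es
  }

-- K₄⁺ : K₄ on 0,1,2,3 with the edge 01 subdivided by the vertex 4
K4⁺ : Graph
K4⁺ = edgeGraph 5 ((0 , 4) ∷ (4 , 1) ∷ (0 , 2) ∷ (0 , 3) ∷ (1 , 2) ∷ (1 , 3) ∷ (2 , 3) ∷ [])

-- G₂ : u=0 v=1 w=2 x=3 y=4
G₂ : Graph
G₂ = edgeGraph 5 ((0 , 1) ∷ (0 , 2) ∷ (1 , 2) ∷ (1 , 3) ∷ (2 , 4) ∷ [])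
G₂x G₂y : Fin 5
G₂x = # 3
G₂y = # 4

-- G₄ : x=0 y=1 u₀=2 u₁=3 v₀=4 v₁=5 w=6
G₄ : Graph
G₄ = edgeGraph 7 ((0 , 3) ∷ (3 , 2) ∷ (3 , 4) ∷ (2 , 5) ∷ (2 , 6) ∷ (4 , 5) ∷ (4 , 6) ∷ (5 , 1) ∷ [])
G₄x G₄y : Fin 7
G₄x = # 0
G₄y = # 1

-- G₈ : x=0 y=1 u₀=2 u₁=3 u₂=4 v₀=5 v₁=6
G₈ : Graph
G₈ = edgeGraph 7 ((0 , 4) ∷ (4 , 3) ∷ (4 , 5) ∷ (3 , 2) ∷ (2 , 5) ∷ (2 , 6) ∷ (5 , 6) ∷ (6 , 1) ∷ [])
G₈x G₈y : Fin 7
G₈x = # 0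
G₈y = # 1

-- H_t on 4 + t + t vertices : x'=0, y'=1, x_i = 2+i, y_i = 3+t+i (0 ≤ i ≤ t)
H-edges : ℕ → List (ℕ × ℕ)
H-edges t =
  (0 , 1) ∷ (0 , 2) ∷ (0 , 3 + t) ∷ (1 , 2) ∷ (1 , 3 + t) ∷ []
  ++ applyUpTo (λ j → (2 + j , 3 + j)) t                 -- x_{i-1}x_i, 1 ≤ i ≤ t
  ++ applyUpTo (λ j → (3 + t + j , 4 + t + j)) t         -- y_{i-1}y_i, 1 ≤ i ≤ t
  ++ applyUpTo (λ j → (3 + j , 4 + t + j)) (t ∸ 1)       -- x_iy_i, 1 ≤ i ≤ t-1

H : ℕ → Graph
H t = edgeGraph (4 + t + t) (H-edges t)

H-xt H-yt : (t : ℕ) → Fin (4 + t + t)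
H-xt t = fromℕ< {2 + t} (s≤s (s≤s (s≤s (m≤n⇒m≤1+n (m≤m+n t t)))))
H-yt t = fromℕ< {3 + t + t} ≤-refl

-- Generic gluing: old graph O, gadget graph W with terminals p q; the
-- gadget minus its terminals is added disjointly, and the terminal p
-- (resp. q) is identified with the old vertex z₁ (resp. z₂).

Inner : (W : Graph) → V W → V W → Set
Inner W p q = Σ (V W) λ w → T (not (⌊ (_≟_ W) w p ⌋ ∨ ⌊ (_≟_ W) w q ⌋))

glue : (O : Graph) (z₁ z₂ : V O) (W : Graph) (p q : V W) → Graph
glue O z₁ z₂ W p q = record
  { V = V O ⊎ Inner W p q
  ; _≟_ = ⊎P.≡-dec (_≟_ O) (ΣP.≡-dec (_≟_ W) λ a b → yes (T-irrelevant a b))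
  ; adj = ad
  }
  where
  att : V O → V W → Bool
  att a w = (⌊ (_≟_ O) a z₁ ⌋ ∧ adj W p w) ∨ (⌊ (_≟_ O) a z₂ ⌋ ∧ adj W q w)
  ad : V O ⊎ Inner W p q → V O ⊎ Inner W p q → Bool
  ad (inj₁ a) (inj₁ b) = adj O a b
  ad (inj₂ w) (inj₂ w') = adj W (proj₁ w) (proj₁ w')
  ad (inj₁ a) (inj₂ w) = att a (proj₁ w)
  ad (inj₂ w) (inj₁ a) = att a (proj₁ w)

deleteVertex : (G : Graph) → V G → Graph
deleteVertex G z = record
  { V = Σ (V G) λ v → T (not ⌊ (_≟_ G) v z ⌋)
  ; _≟_ = ΣP.≡-dec (_≟_ G) λ a b → yes (T-irrelevant a b)
  ; adj = λ a b → adj G (proj₁ a) (proj₁ b)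
  }

deleteEdge : (G : Graph) → V G → V G → Graph
deleteEdge G a b = record
  { V = V G
  ; _≟_ = _≟_ G
  ; adj = λ u v → adj G u v ∧ not ((⌊ (_≟_ G) u a ⌋ ∧ ⌊ (_≟_ G) v b ⌋)
                                   ∨ (⌊ (_≟_ G) u b ⌋ ∧ ⌊ (_≟_ G) v a ⌋))
  }

Degree2 : (G : Graph) → V G → V G → V G → Set
Degree2 G z z₁ z₂ =
  z₁ ≢ z₂ × T (adj G z z₁) × T (adj G z z₂) × (∀ w → T (adj G z w) → w ≡ z₁ ⊎ w ≡ z₂)

replaceDeg2 : (G : Graph) (z z₁ z₂ : V G) → T (not ⌊ (_≟_ G) z₁ z ⌋) → T (not ⌊ (_≟_ G) z₂ z ⌋)
            → (W : Graph) (x y : V W) → Graph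
replaceDeg2 G z z₁ z₂ h₁ h₂ W x y = glue (deleteVertex G z) (z₁ , h₁) (z₂ , h₂) W x y

replaceEdge : (G : Graph) (z₁ z₂ : V G) (t : ℕ) → Graph
replaceEdge G z₁ z₂ t = glue (deleteEdge G z₁ z₂) z₁ z₂ (H t) (H-xt t) (H-yt t)

data InP : Graph → Set₁ where
  base : InP K4⁺
  iso  : ∀ {G G'} → InP G → G ≅ G' → InP G'
  op₂  : ∀ {G} → InP G → (z z₁ z₂ : V G) (d : Degree2 G z z₁ z₂)
         (h₁ : T (not ⌊ (_≟_ G) z₁ z ⌋)) (h₂ : T (not ⌊ (_≟_ G) z₂ z ⌋))
         → InP (replaceDeg2 G z z₁ z₂ h₁ h₂ G₂ G₂x G₂y)
  op₄  : ∀ {G} → InP G → (z z₁ z₂ : V G) (d : Degree2 G z z₁ z₂)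
         (h₁ : T (not ⌊ (_≟_ G) z₁ z ⌋)) (h₂ : T (not ⌊ (_≟_ G) z₂ z ⌋))
         → InP (replaceDeg2 G z z₁ z₂ h₁ h₂ G₄ G₄x G₄y)
  op₈  : ∀ {G} → InP G → (z z₁ z₂ : V G) (d : Degree2 G z z₁ z₂)
         (h₁ : T (not ⌊ (_≟_ G) z₁ z ⌋)) (h₂ : T (not ⌊ (_≟_ G) z₂ z ⌋))
         → InP (replaceDeg2 G z z₁ z₂ h₁ h₂ G₈ G₈x G₈y)
  opH  : ∀ {G} → InP G → (z₁ z₂ : V G) → T (adj G z₁ z₂) → (t : ℕ) → 1 ≤ t
         → InP (replaceEdge G z₁ z₂ t)

-- Lower bound: at a vertex with three distinct neighbours the six incidences pairwise conflict, so a
-- conflict-free incidence 6-colouring shows every colour there.  Fix the colour κ₀ of one incidence at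
-- the single vertex of degree 2; then every vertex lies on an edge with an incidence of colour κ₀, and
-- two such edges cannot share a vertex, so these edges form a perfect matching.  Every graph of 𝒫 has
-- odd order, a contradiction.
--
-- Upper bound: K₄⁺ has an explicit conflict-free incidence 7-colouring.  Each operation cuts one or
-- two incidences of the graph and glues in a gadget whose terminals are leaves; the gadget comes with
-- a colouring that is conflict-free away from its terminals, and after permuting its colours so that
-- the terminal incidences receive the colours of the incidences they replace, the two colourings glue.
-- For G₂, G₄, G₈ the colourings are explicit; for H t it is built from a proper 3-edge-colouring and
-- an orientation, each incidence receiving the class and the direction of its edge.

module Submission where

open import Defs
open import Data.Bool using (Bool; true; false; T; not; _∧_; _∨_; if_then_else_)
open import Data.Bool.Properties using (T-∧; T-∨; T-irrelevant; ∧-comm; ∨-comm)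
open import Data.Nat using (ℕ; zero; suc; _+_; _*_; _∸_; _⊓_; _<_; _≤_; _≡ᵇ_; _<ᵇ_; s≤s; z≤n)
import Data.Nat.Properties as ℕ
open import Data.Nat.Divisibility using (_∣_; divides; _∣?_; ∣m∣n⇒∣m+n; ∣m+n∣m⇒∣n; ∣-refl; _∣0)
open import Data.Fin using (Fin; toℕ; fromℕ<; #_; punchOut; inject≤; inject₁; combine; splitAt; join)
  renaming (zero to fz; suc to fs)
import Data.Fin.Properties as Fin
import Data.Fin.Permutation.Components as Perm
open import Data.List using (List; []; _∷_; _++_; map; length; filter; applyUpTo; allFin)
open import Data.List.Membership.Propositional using (_∈_; find; lose)
import Data.List.Membership.Propositional.Properties as ∈
import Data.List.Properties as List
open import Data.List.Relation.Unary.Any using (here; there)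
import Data.List.Relation.Unary.Any.Properties as Any
open import Data.List.Relation.Unary.All using (All; []; _∷_)
import Data.List.Relation.Unary.All as All
open import Data.List.Relation.Unary.All.Properties using (all-filter)
import Data.List.Relation.Unary.All.Properties as All
open import Data.List.Relation.Unary.Unique.Propositional using (Unique; []; _∷_)
import Data.List.Relation.Unary.Unique.Propositional.Properties as Unique
open import Data.Product using (Σ; _×_; _,_; proj₁; proj₂; ∃)
open import Data.Product.Properties using (,-injectiveˡ; ,-injectiveʳ)
open import Data.Sum using (_⊎_; inj₁; inj₂; [_,_]′)
import Data.Sum as Sum
open import Data.Empty using (⊥; ⊥-elim)
open import Data.Unit using (⊤; tt)
open import Function using (_∘_; _⇔_; Equivalence; mk⇔)
open import Function.Bundles using (_↔_; Inverse)
open import Relation.Nullary using (¬_; yes; no; Dec)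
open import Relation.Nullary.Decidable
  using (⌊_⌋; True; toWitness; fromWitness; toWitnessFalse; ¬?; _→-dec_; T?; dec-true; dec-false; map′; _×-dec_)
open import Relation.Binary.Definitions using (DecidableEquality)
open import Relation.Binary.PropositionalEquality
  using (_≡_; _≢_; refl; sym; trans; cong; cong₂; subst; subst₂; ≢-sym; module ≡-Reasoning)

T-not : ∀ {x} → T (not x) ⇔ (¬ T x)
T-not {true} = mk⇔ (λ ()) (λ f → f tt)
T-not {false} = mk⇔ (λ _ ()) (λ _ → tt)

Adj : (G : Graph) → V G → V G → Set
Adj G a b = T (adj G a b)

IsSymmetric : Graph → Set
IsSymmetric G = ∀ a b → Adj G a b → Adj G b a

IsIrreflexive : Graph → Set
IsIrreflexive G = ∀ a → ¬ Adj G a a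

-- A colouring of incidences given on ordered pairs: (v , u) stands for the incidence (v , vu).
record ConflictFreeAt {C : Set} (G : Graph) (c : V G → V G → C) (w : V G) : Set where
  field
    out-out : ∀ u u′ → Adj G w u → Adj G w u′ → u ≢ u′ → c w u ≢ c w u′
    in-in   : ∀ u u′ → Adj G u w → Adj G u′ w → u ≢ u′ → c u w ≢ c u′ w
    out-in  : ∀ u u′ → Adj G w u → Adj G u′ w → c w u ≢ c u′ w

conflictFree⇒IsCFIncColouring : ∀ {k} (G : Graph) (c : V G → V G → Fin k) →
  (∀ w → ConflictFreeAt G c w) → IsCFIncColouring G k (λ i → c (proj₁ (proj₁ i)) (proj₂ (proj₁ i)))
conflictFree⇒IsCFIncColouring G c cf ((v , u) , e) ((v′ , u′) , e′) ne (w , inj₁ refl , inj₁ refl) =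
  ConflictFreeAt.out-out (cf v) u u′ e e′ (λ { refl → ne refl })
conflictFree⇒IsCFIncColouring G c cf ((v , u) , e) ((v′ , u′) , e′) ne (w , inj₂ refl , inj₂ refl) =
  ConflictFreeAt.in-in (cf u) v v′ e e′ (λ { refl → ne refl })
conflictFree⇒IsCFIncColouring G c cf ((v , u) , e) ((v′ , u′) , e′) ne (w , inj₁ refl , inj₂ refl) =
  ConflictFreeAt.out-in (cf v) u v′ e e′
conflictFree⇒IsCFIncColouring G c cf ((v , u) , e) ((v′ , u′) , e′) ne (w , inj₂ refl , inj₁ refl) =
  ≢-sym (ConflictFreeAt.out-in (cf u) u′ v e′ e)

conflictFreeAt-relabel : ∀ {C D : Set} (G : Graph) (c : V G → V G → C) (π : C → D) →
  (∀ {a b} → π a ≡ π b → a ≡ b) → ∀ w → ConflictFreeAt G c w → ConflictFreeAt G (λ a b → π (c a b)) w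
conflictFreeAt-relabel G c π π-inj w cf = record
  { out-out = λ u u′ a a′ ne → out-out u u′ a a′ ne ∘ π-inj
  ; in-in   = λ u u′ a a′ ne → in-in u u′ a a′ ne ∘ π-inj
  ; out-in  = λ u u′ a a′ → out-in u u′ a a′ ∘ π-inj
  }
  where open ConflictFreeAt cf

-- Conflict-freeness at w only involves the neighbourhood of w, so it can be pulled back along
-- any map that is locally injective at w and preserves adjacency and colours there.
conflictFreeAt-pullback : ∀ {C : Set} (G H : Graph) (c : V G → V G → C) (d : V H → V H → C)
  (w : V G) (w′ : V H) (φ : V G → V H) → IsSymmetric G → IsSymmetric H
  → (∀ y → Adj G w y → Adj H w′ (φ y))
  → (∀ y → Adj G w y → c w y ≡ d w′ (φ y))
  → (∀ y → Adj G w y → c y w ≡ d (φ y) w′)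
  → (∀ y y′ → Adj G w y → Adj G w y′ → φ y ≡ φ y′ → y ≡ y′)
  → ConflictFreeAt H d w′ → ConflictFreeAt G c w
conflictFreeAt-pullback G H c d w w′ φ symG symH adjφ out≡ in≡ φ-inj cf = record
  { out-out = λ u u′ a a′ ne e → out-out (φ u) (φ u′) (adjφ u a) (adjφ u′ a′)
      (ne ∘ φ-inj u u′ a a′) (trans (sym (out≡ u a)) (trans e (out≡ u′ a′)))
  ; in-in = λ u u′ a a′ ne e →
      let b = symG u w a ; b′ = symG u′ w a′ in
      in-in (φ u) (φ u′) (symH w′ (φ u) (adjφ u b)) (symH w′ (φ u′) (adjφ u′ b′))
        (ne ∘ φ-inj u u′ b b′) (trans (sym (in≡ u b)) (trans e (in≡ u′ b′)))
  ; out-in = λ u u′ a a′ e →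
      let b′ = symG u′ w a′ in
      out-in (φ u) (φ u′) (adjφ u a) (symH w′ (φ u′) (adjφ u′ b′))
        (trans (sym (out≡ u a)) (trans e (in≡ u′ b′)))
  }
  where open ConflictFreeAt cf

-- Two incidences at w can share the edge colour only if they lie on the same edge, and then the
-- direction of that edge tells them apart.
edgeColouring⇒conflictFreeAt : ∀ {C : Set} (G : Graph) (ε : V G → V G → C) (o : V G → V G → Bool)
  → IsSymmetric G → (∀ a b → ε a b ≡ ε b a) → ∀ w
  → (∀ u u′ → Adj G w u → Adj G w u′ → ε w u ≡ ε w u′ → u ≡ u′)
  → (∀ u → Adj G w u → o w u ≢ o u w)
  → ConflictFreeAt G (λ a b → ε a b , o a b) w
edgeColouring⇒conflictFreeAt G ε o symG ε-sym w proper antisym = record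
  { out-out = λ u u′ a a′ ne e → ne (proper u u′ a a′ (,-injectiveˡ e))
  ; in-in = λ u u′ a a′ ne e →
      ne (proper u u′ (symG u w a) (symG u′ w a′) (trans (ε-sym w u) (trans (,-injectiveˡ e) (ε-sym u′ w))))
  ; out-in = λ u u′ a a′ e →
      let u≡u′ = proper u u′ a (symG u′ w a′) (trans (,-injectiveˡ e) (ε-sym u′ w))
      in antisym u a (trans (,-injectiveʳ e) (cong (λ x → o x w) (sym u≡u′)))
  }

record Neighbours (G : Graph) (v : V G) (k : ℕ) : Set where
  field
    neighbour : Fin k → V G
    adjacent  : ∀ i → Adj G v (neighbour i)
    injective : ∀ {i j} → neighbour i ≡ neighbour j → i ≡ j

neighbours-transport : ∀ {k} (G H : Graph) (v : V G) (w : V H)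
  (φ : ∀ u → Adj H w u → V G) → (∀ u a → Adj G v (φ u a))
  → (r : V G → V H) → (∀ u a → r (φ u a) ≡ u)
  → Neighbours H w k → Neighbours G v k
neighbours-transport G H v w φ φ-adj r rφ nb = record
  { neighbour = λ i → φ (neighbour i) (adjacent i)
  ; adjacent  = λ i → φ-adj (neighbour i) (adjacent i)
  ; injective = λ {i} {j} e → injective
      (trans (sym (rφ _ (adjacent i))) (trans (cong r e) (rφ _ (adjacent j))))
  }
  where open Neighbours nb

neighbours₁ : ∀ (G : Graph) {v} u → Adj G v u → Neighbours G v 1
neighbours₁ G u a = record
  { neighbour = λ _ → u ; adjacent = λ _ → a ; injective = λ { {fz} {fz} _ → refl } }

neighbours₃ : ∀ (G : Graph) {v} u₀ u₁ u₂ → Adj G v u₀ → Adj G v u₁ → Adj G v u₂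
  → u₀ ≢ u₁ → u₀ ≢ u₂ → u₁ ≢ u₂ → Neighbours G v 3
neighbours₃ G u₀ u₁ u₂ a₀ a₁ a₂ n01 n02 n12 = record
  { neighbour = nb ; adjacent = adj′ ; injective = inj }
  where
  nb : Fin 3 → _
  nb fz = u₀
  nb (fs fz) = u₁
  nb (fs (fs fz)) = u₂
  adj′ : ∀ i → Adj G _ (nb i)
  adj′ fz = a₀
  adj′ (fs fz) = a₁
  adj′ (fs (fs fz)) = a₂
  inj : ∀ {i j} → nb i ≡ nb j → i ≡ j
  inj {fz} {fz} e = refl
  inj {fz} {fs fz} e = ⊥-elim (n01 e)
  inj {fz} {fs (fs fz)} e = ⊥-elim (n02 e)
  inj {fs fz} {fz} e = ⊥-elim (n01 (sym e))
  inj {fs fz} {fs fz} e = refl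
  inj {fs fz} {fs (fs fz)} e = ⊥-elim (n12 e)
  inj {fs (fs fz)} {fz} e = ⊥-elim (n02 (sym e))
  inj {fs (fs fz)} {fs fz} e = ⊥-elim (n12 (sym e))
  inj {fs (fs fz)} {fs (fs fz)} e = refl

-- Enumerations and parity

record Enumeration (A : Set) : Set where
  field
    elements : List A
    unique   : Unique elements
    complete : ∀ a → a ∈ elements

  size : ℕ
  size = length elements

Odd : ℕ → Set
Odd n = ¬ 2 ∣ n

odd+even : ∀ {m n} → Odd m → 2 ∣ n → Odd (m + n)
odd+even {m} {n} odd-m 2∣n 2∣m+n = odd-m (∣m+n∣m⇒∣n (subst (2 ∣_) (ℕ.+-comm m n) 2∣m+n) 2∣n)

2∣n⊎2∣1+n : ∀ n → 2 ∣ n ⊎ 2 ∣ suc n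
2∣n⊎2∣1+n zero = inj₁ (2 ∣0)
2∣n⊎2∣1+n (suc n) with 2∣n⊎2∣1+n n
... | inj₁ 2∣n = inj₂ (∣m∣n⇒∣m+n ∣-refl 2∣n)
... | inj₂ 2∣1+n = inj₁ 2∣1+n

oddSuc+odd : ∀ {m n} → Odd (suc m) → Odd n → Odd (m + n)
oddSuc+odd {m} {n} odd-1+m odd-n with 2∣n⊎2∣1+n m
... | inj₁ 2∣m = subst Odd (ℕ.+-comm n m) (odd+even odd-n 2∣m)
... | inj₂ 2∣1+m = ⊥-elim (odd-1+m 2∣1+m)

module _ {A : Set} (_≟_ : DecidableEquality A) where

  remove : A → List A → List A
  remove a = filter (λ x → ¬? (x ≟ a))

  length-remove : ∀ {a} xs → Unique xs → a ∈ xs → suc (length (remove a xs)) ≡ length xs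
  length-remove {a} (x ∷ xs) (x∉xs ∷ u) (here refl) with x ≟ x
  ... | no x≢x = ⊥-elim (x≢x refl)
  ... | yes _ = cong (suc ∘ length) (List.filter-all (λ x → ¬? (x ≟ a)) x-absent)
    where
    x-absent : All (λ y → ¬ y ≡ x) xs
    x-absent = All.tabulate λ y∈xs y≡x → All.lookup x∉xs y∈xs (sym y≡x)
  length-remove {a} (x ∷ xs) (x∉xs ∷ u) (there a∈xs) with x ≟ a
  ... | yes refl = ⊥-elim (All.lookup x∉xs a∈xs refl)
  ... | no _ = cong suc (length-remove xs u a∈xs)

  length-filter+rejected : ∀ {P : A → Set} (P? : ∀ a → Dec (P a)) xs ys → Unique xs → Unique ys
    → (∀ {y} → y ∈ ys → y ∈ xs × ¬ P y) → (∀ {x} → x ∈ xs → P x ⊎ x ∈ ys)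
    → length (filter P? xs) + length ys ≡ length xs
  length-filter+rejected P? [] [] _ _ _ _ = refl
  length-filter+rejected P? [] (y ∷ ys) _ _ rejected _ with () ← proj₁ (rejected (here refl))
  length-filter+rejected {P} P? (x ∷ xs) ys (x∉xs ∷ u) uys rejected cover with P? x
  ... | yes px = cong suc (length-filter+rejected P? xs ys u uys rejected′ (cover ∘ there))
    where
    rejected′ : ∀ {y} → y ∈ ys → y ∈ xs × ¬ P y
    rejected′ y∈ys with rejected y∈ys
    ... | here refl , ¬py = ⊥-elim (¬py px)
    ... | there y∈xs , ¬py = y∈xs , ¬py
  ... | no ¬px = begin
      length (filter P? xs) + length ys         ≡⟨ cong (length (filter P? xs) +_) (sym (length-remove ys uys x∈ys)) ⟩
      length (filter P? xs) + suc (length ys′)  ≡⟨ ℕ.+-suc _ _ ⟩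
      suc (length (filter P? xs) + length ys′)  ≡⟨ cong suc (length-filter+rejected P? xs ys′ u uys′ rejected′ cover′) ⟩
      suc (length xs)                           ∎
    where
    open ≡-Reasoning
    x∈ys : x ∈ ys
    x∈ys = [ (λ px → ⊥-elim (¬px px)) , (λ x∈ys → x∈ys) ]′ (cover (here refl))
    ys′ = remove x ys
    uys′ : Unique ys′
    uys′ = Unique.filter⁺ _ uys
    rejected′ : ∀ {y} → y ∈ ys′ → y ∈ xs × ¬ P y
    rejected′ y∈ys′ with ∈.∈-filter⁻ _ y∈ys′
    ... | y∈ys , y≢x with rejected y∈ys
    ...   | here y≡x , _ = ⊥-elim (y≢x y≡x)
    ...   | there y∈xs , ¬py = y∈xs , ¬py
    cover′ : ∀ {z} → z ∈ xs → P z ⊎ z ∈ ys′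
    cover′ {z} z∈xs with cover (there z∈xs)
    ... | inj₁ pz = inj₁ pz
    ... | inj₂ z∈ys = inj₂ (∈.∈-filter⁺ _ z∈ys λ z≡x → All.lookup x∉xs z∈xs (sym z≡x))

  involution-closed⇒even : (f : A → A) → (∀ a → f (f a) ≡ a) → (∀ a → f a ≢ a)
    → ∀ n xs → length xs ≡ n → Unique xs → (∀ {a} → a ∈ xs → f a ∈ xs) → 2 ∣ n
  involution-closed⇒even f invol fixfree zero [] _ _ _ = 2 ∣0
  involution-closed⇒even f invol fixfree (suc n) (a ∷ xs) len u closed with closed (here refl)
  involution-closed⇒even f invol fixfree (suc n) (a ∷ xs) len u closed | here fa≡a = ⊥-elim (fixfree a fa≡a)
  involution-closed⇒even f invol fixfree (suc zero) (a ∷ []) len u closed | there ()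
  involution-closed⇒even f invol fixfree (suc (suc n)) (a ∷ xs) len (a∉xs ∷ u) closed | there fa∈xs =
    ∣m∣n⇒∣m+n ∣-refl (involution-closed⇒even f invol fixfree n rest len-rest (Unique.filter⁺ _ u) closed-rest)
    where
    rest = remove (f a) xs
    len-rest : length rest ≡ n
    len-rest = ℕ.suc-injective (trans (length-remove xs u fa∈xs) (ℕ.suc-injective len))
    f-injective : ∀ {b c} → f b ≡ f c → b ≡ c
    f-injective {b} {c} e = trans (sym (invol b)) (trans (cong f e) (invol c))
    closed-rest : ∀ {b} → b ∈ rest → f b ∈ rest
    closed-rest b∈rest with ∈.∈-filter⁻ _ b∈rest
    ... | b∈xs , b≢fa with closed (there b∈xs)
    ...   | here fb≡a = ⊥-elim (b≢fa (trans (sym (invol _)) (cong f fb≡a)))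
    ...   | there fb∈xs = ∈.∈-filter⁺ _ fb∈xs λ fb≡fa → All.lookup a∉xs b∈xs (sym (f-injective fb≡fa))

fixedPointFreeInvolution⇒even : ∀ {A : Set} → DecidableEquality A → (e : Enumeration A)
  (f : A → A) → (∀ a → f (f a) ≡ a) → (∀ a → f a ≢ a) → 2 ∣ Enumeration.size e
fixedPointFreeInvolution⇒even _≟_ e f invol fixfree =
  involution-closed⇒even _≟_ f invol fixfree _ elements refl unique (λ {a} _ → complete (f a))
  where open Enumeration e

module _ {A : Set} where

  map-proj₁-toList : ∀ {P : A → Set} {xs} (pxs : All P xs) → map proj₁ (All.toList pxs) ≡ xs
  map-proj₁-toList [] = refl
  map-proj₁-toList (px ∷ pxs) = cong (_ ∷_) (map-proj₁-toList pxs)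

  Σ-≡ : ∀ {P : A → Bool} {a b : Σ A (T ∘ P)} → proj₁ a ≡ proj₁ b → a ≡ b
  Σ-≡ {a = x , s} {b = .x , t} refl = cong (x ,_) (T-irrelevant s t)

  subtypeEnumeration : (P : A → Bool) → Enumeration A → Enumeration (Σ A (T ∘ P))
  subtypeEnumeration P e = record
    { elements = All.toList selected
    ; unique = Unique.map⁻ (subst Unique (sym (map-proj₁-toList selected)) (Unique.filter⁺ (T? ∘ P) unique))
    ; complete = complete′
    }
    where
    open Enumeration e
    selected = all-filter (T? ∘ P) elements
    complete′ : ∀ a → a ∈ All.toList selected
    complete′ (a , t) with ∈.∈-map⁻ proj₁ (subst (a ∈_) (sym (map-proj₁-toList selected))
                                                    (∈.∈-filter⁺ (T? ∘ P) (complete a) t))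
    ... | b , b∈ , a≡b = subst (_∈ All.toList selected) (Σ-≡ (sym a≡b)) b∈

  size-subtypeEnumeration : ∀ (P : A → Bool) (e : Enumeration A) →
    Enumeration.size (subtypeEnumeration P e) ≡ length (filter (T? ∘ P) (Enumeration.elements e))
  size-subtypeEnumeration P e = begin
    length (All.toList selected)             ≡⟨ sym (List.length-map proj₁ (All.toList selected)) ⟩
    length (map proj₁ (All.toList selected)) ≡⟨ cong length (map-proj₁-toList selected) ⟩
    length (filter (T? ∘ P) (Enumeration.elements e)) ∎
    where
    open ≡-Reasoning
    selected = all-filter (T? ∘ P) (Enumeration.elements e)

module _ {A B : Set} where

  sumEnumeration : Enumeration A → Enumeration B → Enumeration (A ⊎ B)
  sumEnumeration eA eB = record
    { elements = map inj₁ (elements eA) ++ map inj₂ (elements eB)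
    ; unique = Unique.++⁺ (Unique.map⁺ (λ { refl → refl }) (unique eA))
                          (Unique.map⁺ (λ { refl → refl }) (unique eB)) disjoint
    ; complete = λ { (inj₁ a) → ∈.∈-++⁺ˡ (∈.∈-map⁺ inj₁ (complete eA a))
                   ; (inj₂ b) → ∈.∈-++⁺ʳ _ (∈.∈-map⁺ inj₂ (complete eB b)) }
    }
    where
    open Enumeration
    disjoint : ∀ {x} → x ∈ map inj₁ (elements eA) × x ∈ map inj₂ (elements eB) → ⊥
    disjoint (l , r) with ∈.∈-map⁻ inj₁ l | ∈.∈-map⁻ inj₂ r
    ... | _ , _ , refl | _ , _ , ()

  size-sumEnumeration : ∀ (eA : Enumeration A) (eB : Enumeration B) →
    Enumeration.size (sumEnumeration eA eB) ≡ Enumeration.size eA + Enumeration.size eB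
  size-sumEnumeration eA eB = trans (List.length-++ (map inj₁ (Enumeration.elements eA)))
    (cong₂ _+_ (List.length-map inj₁ (Enumeration.elements eA)) (List.length-map inj₂ (Enumeration.elements eB)))

-- No conflict-free incidence (d + d)-colouring

injective⇒surjective : ∀ {n} (h : Fin n → Fin n) → (∀ {i j} → h i ≡ h j → i ≡ j) → ∀ y → ∃ λ i → h i ≡ y
injective⇒surjective {suc n} h h-inj y with Fin.any? (λ i → h i Fin.≟ y)
... | yes hit = hit
... | no miss with Fin.pigeonhole (ℕ.n<1+n n) (λ i → punchOut {i = y} {j = h i} (λ e → miss (i , sym e)))
... | i , j , i<j , e =
  ⊥-elim (Fin.<-irrefl (h-inj (Fin.punchOut-injective (λ e′ → miss (i , sym e′)) (λ e′ → miss (j , sym e′)) e)) i<j)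

splitAt-injective : ∀ m {n} {i j : Fin (m + n)} → splitAt m i ≡ splitAt m j → i ≡ j
splitAt-injective m {n} {i} {j} e =
  trans (sym (Fin.join-splitAt m n i)) (trans (cong (join m n) e) (Fin.join-splitAt m n j))

-- A vertex with d distinct neighbours has 2d pairwise conflicting incidences, so with d + d colours
-- it sees every colour; the incidences of one fixed colour therefore match up the vertices in pairs.
module NoCFIncColouring
  (G : Graph) (symG : IsSymmetric G) (irrG : IsIrreflexive G)
  (e : Enumeration (V G)) (odd : Odd (Enumeration.size e))
  (d : ℕ) (x x₁ : V G) (x-adj : Adj G x x₁) (deg : ∀ v → v ≢ x → Neighbours G v d)
  (κ : Incidence G → Fin (d + d)) (κ-cf : IsCFIncColouring G (d + d) κ)
  where

  κ₀ : Fin (d + d)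
  κ₀ = κ ((x , x₁) , x-adj)

  SeesOnEdge : V G → V G → Set
  SeesOnEdge v u = Σ (Adj G v u) λ a → κ ((v , u) , a) ≡ κ₀ ⊎ κ ((u , v) , symG v u a) ≡ κ₀

  module AtVertex (v : V G) (nb : Neighbours G v d) where
    open Neighbours nb

    incidence : Fin d ⊎ Fin d → Incidence G
    incidence (inj₁ i) = (v , neighbour i) , adjacent i
    incidence (inj₂ i) = (neighbour i , v) , symG v _ (adjacent i)

    incidence-∈I : ∀ i → _∈I_ {G} (incidence i) v
    incidence-∈I (inj₁ _) = inj₁ refl
    incidence-∈I (inj₂ _) = inj₂ refl

    not-loop : ∀ i → v ≢ neighbour i
    not-loop i e = irrG v (subst (Adj G v) (sym e) (adjacent i))

    incidence-injective : ∀ i j → proj₁ (incidence i) ≡ proj₁ (incidence j) → i ≡ j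
    incidence-injective (inj₁ i) (inj₁ j) e = cong inj₁ (injective (,-injectiveʳ e))
    incidence-injective (inj₁ i) (inj₂ j) e = ⊥-elim (not-loop j (,-injectiveˡ e))
    incidence-injective (inj₂ i) (inj₁ j) e = ⊥-elim (not-loop i (sym (,-injectiveˡ e)))
    incidence-injective (inj₂ i) (inj₂ j) e = cong inj₂ (injective (,-injectiveˡ e))

    colours : Fin (d + d) → Fin (d + d)
    colours = κ ∘ incidence ∘ splitAt d

    colours-injective : ∀ {i j} → colours i ≡ colours j → i ≡ j
    colours-injective {i} {j} e with i Fin.≟ j
    ... | yes i≡j = i≡j
    ... | no i≢j = ⊥-elim (κ-cf _ _ (i≢j ∘ splitAt-injective d ∘ incidence-injective (splitAt d i) (splitAt d j))
                                    (v , incidence-∈I (splitAt d i) , incidence-∈I (splitAt d j)) e)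

    sees : ∃ (SeesOnEdge v)
    sees with injective⇒surjective colours colours-injective κ₀
    ... | i , hit with splitAt d i
    ...   | inj₁ j = neighbour j , adjacent j , inj₁ hit
    ...   | inj₂ j = neighbour j , adjacent j , inj₂ hit

  sees : ∀ v → ∃ (SeesOnEdge v)
  sees v with (_≟_ G) v x
  ... | yes refl = x₁ , x-adj , inj₁ refl
  ... | no v≢x = AtVertex.sees v (deg v v≢x)

  partner : V G → V G
  partner v = proj₁ (sees v)

  partner-fixfree : ∀ v → partner v ≢ v
  partner-fixfree v e = irrG v (subst (Adj G v) e (proj₁ (proj₂ (sees v))))

  EdgeIncidence : V G → V G → Incidence G → Set
  EdgeIncidence v u i = proj₁ i ≡ (v , u) ⊎ proj₁ i ≡ (u , v)

  coloured : ∀ v → Σ (Incidence G) λ i → κ i ≡ κ₀ × EdgeIncidence v (partner v) i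
  coloured v with sees v
  ... | u , a , inj₁ k = _ , k , inj₁ refl
  ... | u , a , inj₂ k = _ , k , inj₂ refl

  partner-involutive : ∀ v → partner (partner v) ≡ v
  partner-involutive v with (_≟_ G) (partner (partner v)) v
  ... | yes p = p
  ... | no ¬p with coloured v | coloured (partner v)
  ... | i , κi , vi | j , κj , uj =
    ⊥-elim (κ-cf i j (distinct vi uj) (partner v , at-u₁ vi , at-u₂ uj) (trans κi (sym κj)))
    where
    u = partner v
    at-u₁ : EdgeIncidence v u i → _∈I_ {G} i u
    at-u₁ (inj₁ e) = inj₂ (cong proj₂ e)
    at-u₁ (inj₂ e) = inj₁ (cong proj₁ e)
    at-u₂ : EdgeIncidence u (partner u) j → _∈I_ {G} j u
    at-u₂ (inj₁ e) = inj₁ (cong proj₁ e)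
    at-u₂ (inj₂ e) = inj₂ (cong proj₂ e)
    distinct : EdgeIncidence v u i → EdgeIncidence u (partner u) j → proj₁ i ≢ proj₁ j
    distinct (inj₁ a) (inj₁ b) q = partner-fixfree v (sym (cong proj₁ (trans (sym a) (trans q b))))
    distinct (inj₁ a) (inj₂ b) q = ¬p (sym (cong proj₁ (trans (sym a) (trans q b))))
    distinct (inj₂ a) (inj₁ b) q = ¬p (sym (cong proj₂ (trans (sym a) (trans q b))))
    distinct (inj₂ a) (inj₂ b) q = partner-fixfree v (sym (cong proj₂ (trans (sym a) (trans q b))))

  contradiction : ⊥
  contradiction = odd (fixedPointFreeInvolution⇒even (_≟_ G) e partner partner-involutive partner-fixfree)

-- Graphs of 𝒫 have odd order and degree 3 everywhere except at one vertex of degree 2; of that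
-- vertex only a single neighbour is ever needed.
record Admissible (G : Graph) : Set where
  field
    symmetric     : IsSymmetric G
    irreflexive   : IsIrreflexive G
    enumeration   : Enumeration (V G)
    odd-order     : Odd (Enumeration.size enumeration)
    exceptional   : V G
    exceptional-neighbour : Neighbours G exceptional 1
    three-neighbours      : ∀ v → v ≢ exceptional → Neighbours G v 3
    colouring     : V G → V G → Fin 7
    conflictFree  : ∀ w → ConflictFreeAt G colouring w

admissible⇒χic≡7 : ∀ {G} → Admissible G → χic≡ G 7
admissible⇒χic≡7 {G} g = (_ , conflictFree⇒IsCFIncColouring G colouring conflictFree) , fewer
  where
  open Admissible g
  fewer : ∀ k → k < 7 → ¬ CFIncColourable G k
  fewer k k<7 (κ , κ-cf) = NoCFIncColouring.contradiction G symmetric irreflexive enumeration odd-order 3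
    exceptional _ (Neighbours.adjacent exceptional-neighbour fz) three-neighbours
    (λ i → inject≤ (κ i) k≤6) (λ i j ne c e → κ-cf i j ne c (Fin.inject≤-injective k≤6 k≤6 _ _ e))
    where
    k≤6 : k ≤ 6
    k≤6 = ℕ.≤-pred k<7

module _ {n : ℕ} where

  transpose-sends : (i j : Fin n) → Perm.transpose i j i ≡ j
  transpose-sends i j rewrite dec-true (i Fin.≟ i) refl = refl

  transpose-fixes : (i j k : Fin n) → k ≢ i → k ≢ j → Perm.transpose i j k ≡ k
  transpose-fixes i j k k≢i k≢j rewrite dec-false (k Fin.≟ i) k≢i | dec-false (k Fin.≟ j) k≢j = refl

  transpose-injective : (i j : Fin n) {a b : Fin n} → Perm.transpose i j a ≡ Perm.transpose i j b → a ≡ b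
  transpose-injective i j {a} {b} e =
    trans (sym (Perm.transpose-inverse j i)) (trans (cong (Perm.transpose j i) e) (Perm.transpose-inverse j i))

  injection-sending : (ps : List (Fin n × Fin n)) → Unique (map proj₁ ps) → Unique (map proj₂ ps) →
    Σ (Fin n → Fin n) λ π → (∀ {a b} → π a ≡ π b → a ≡ b) × All (λ p → π (proj₁ p) ≡ proj₂ p) ps
  injection-sending [] _ _ = (λ a → a) , (λ e → e) , []
  injection-sending ((x , y) ∷ ps) (x∉ ∷ us) (y∉ ∷ vs) with injection-sending ps us vs
  ... | π , π-inj , sent = π′ , π′-inj , transpose-sends (π x) y ∷ sent′
    where
    π′ : Fin n → Fin n
    π′ a = Perm.transpose (π x) y (π a)
    π′-inj : ∀ {a b} → π′ a ≡ π′ b → a ≡ b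
    π′-inj = π-inj ∘ transpose-injective (π x) y
    sent′ : All (λ p → π′ (proj₁ p) ≡ proj₂ p) ps
    sent′ = All.zipWith
      (λ { {x′ , y′} (x≢x′ , y≢y′ , πx′≡y′) →
           trans (cong (Perm.transpose (π x) y) πx′≡y′)
             (transpose-fixes (π x) y y′ (λ e → x≢x′ (sym (π-inj (trans πx′≡y′ e))))
                (≢-sym y≢y′)) })
      (All.map⁻ x∉ , All.zip (All.map⁻ y∉ , sent))

module _ (m : ℕ) (es : List (ℕ × ℕ)) where

  private
    E = edgeGraph m es

    joins : Fin m → Fin m → ℕ × ℕ → Bool
    joins a b e = ((toℕ a ≡ᵇ proj₁ e) ∧ (toℕ b ≡ᵇ proj₂ e)) ∨ ((toℕ a ≡ᵇ proj₂ e) ∧ (toℕ b ≡ᵇ proj₁ e))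

  edgeGraph-symmetric : IsSymmetric E
  edgeGraph-symmetric a b = subst T (adj-sym es)
    where
    adj-sym : ∀ es′ → adj (edgeGraph m es′) a b ≡ adj (edgeGraph m es′) b a
    adj-sym [] = refl
    adj-sym ((x , y) ∷ es′) = cong₂ _∨_
      (trans (∨-comm ((toℕ a ≡ᵇ x) ∧ (toℕ b ≡ᵇ y)) _) (cong₂ _∨_ (∧-comm (toℕ a ≡ᵇ y) _) (∧-comm (toℕ a ≡ᵇ x) _)))
      (adj-sym es′)

  edgeGraph-adj⁻ : ∀ a b → Adj E a b → (toℕ a , toℕ b) ∈ es ⊎ (toℕ b , toℕ a) ∈ es
  edgeGraph-adj⁻ a b t with find (Any.any⁻ (joins a b) es t)
  ... | (x , y) , e∈es , match with Equivalence.to T-∨ match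
  ...   | inj₁ fwd = inj₁ (subst (_∈ es) (endpoints (Equivalence.to T-∧ fwd)) e∈es)
    where
    endpoints : T (toℕ a ≡ᵇ x) × T (toℕ b ≡ᵇ y) → (x , y) ≡ (toℕ a , toℕ b)
    endpoints (p , q) = sym (cong₂ _,_ (ℕ.≡ᵇ⇒≡ _ _ p) (ℕ.≡ᵇ⇒≡ _ _ q))
  ...   | inj₂ bwd = inj₂ (subst (_∈ es) (endpoints (Equivalence.to T-∧ bwd)) e∈es)
    where
    endpoints : T (toℕ a ≡ᵇ y) × T (toℕ b ≡ᵇ x) → (x , y) ≡ (toℕ b , toℕ a)
    endpoints (p , q) = sym (cong₂ _,_ (ℕ.≡ᵇ⇒≡ _ _ q) (ℕ.≡ᵇ⇒≡ _ _ p))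

  edgeGraph-adj⁺ : ∀ a b → (toℕ a , toℕ b) ∈ es → Adj E a b
  edgeGraph-adj⁺ a b e∈es = Any.any⁺ (joins a b) (lose {P = T ∘ joins a b} e∈es
    (Equivalence.from (T-∨ {(toℕ a ≡ᵇ toℕ a) ∧ (toℕ b ≡ᵇ toℕ b)})
      (inj₁ (Equivalence.from T-∧ (ℕ.≡⇒≡ᵇ (toℕ a) _ refl , ℕ.≡⇒≡ᵇ (toℕ b) _ refl)))))

  irreflexive? : Dec (IsIrreflexive E)
  irreflexive? = Fin.all? λ a → ¬? (T? (adj E a a))

  conflictFreeAt? : ∀ {k} (c : Fin m → Fin m → Fin k) w → Dec (ConflictFreeAt E c w)
  conflictFreeAt? c w = map′ (λ (oo , ii , oi) → record { out-out = oo ; in-in = ii ; out-in = oi })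
    (λ cf → ConflictFreeAt.out-out cf , ConflictFreeAt.in-in cf , ConflictFreeAt.out-in cf)
    (pairs (λ u u′ → T? (adj E w u) →-dec (T? (adj E w u′) →-dec (¬? (u Fin.≟ u′) →-dec ¬? (c w u Fin.≟ c w u′))))
     ×-dec pairs (λ u u′ → T? (adj E u w) →-dec (T? (adj E u′ w) →-dec (¬? (u Fin.≟ u′) →-dec ¬? (c u w Fin.≟ c u′ w))))
     ×-dec pairs (λ u u′ → T? (adj E w u) →-dec (T? (adj E u′ w) →-dec ¬? (c w u Fin.≟ c u′ w))))
    where
    pairs : ∀ {P : Fin m → Fin m → Set} → (∀ u u′ → Dec (P u u′)) → Dec (∀ u u′ → P u u′)
    pairs P? = Fin.all? λ u → Fin.all? (P? u)

-- Pairs that are not listed (in particular all non-adjacent pairs) get the irrelevant colour 0.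
colourTable : ∀ {m} → List (ℕ × ℕ × Fin 7) → Fin m → Fin m → Fin 7
colourTable [] a b = fz
colourTable ((x , y , k) ∷ rest) a b = if (toℕ a ≡ᵇ x) ∧ (toℕ b ≡ᵇ y) then k else colourTable rest a b

allFinEnumeration : ∀ n → Enumeration (Fin n)
allFinEnumeration n = record { elements = allFin n ; unique = Unique.allFin⁺ n ; complete = ∈.∈-allFin }

admissible-K4⁺ : Admissible K4⁺
admissible-K4⁺ = record
  { symmetric = edgeGraph-symmetric 5 edges
  ; irreflexive = toWitness {a? = irreflexive? 5 edges} tt
  ; enumeration = allFinEnumeration 5
  ; odd-order = toWitnessFalse {a? = 2 ∣? 5} tt
  ; exceptional = # 4
  ; exceptional-neighbour = neighbours₁ K4⁺ (# 0) tt
  ; three-neighbours = three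
  ; colouring = colouring
  ; conflictFree = toWitness {a? = Fin.all? (conflictFreeAt? 5 edges colouring)} tt
  }
  where
  edges = (0 , 4) ∷ (4 , 1) ∷ (0 , 2) ∷ (0 , 3) ∷ (1 , 2) ∷ (1 , 3) ∷ (2 , 3) ∷ []
  colouring : Fin 5 → Fin 5 → Fin 7
  colouring = colourTable
    ((0 , 4 , # 0) ∷ (4 , 0 , # 1) ∷ (4 , 1 , # 2) ∷ (1 , 4 , # 3) ∷ (0 , 2 , # 2) ∷ (2 , 0 , # 4) ∷
     (0 , 3 , # 5) ∷ (3 , 0 , # 6) ∷ (1 , 2 , # 5) ∷ (2 , 1 , # 6) ∷ (1 , 3 , # 0) ∷ (3 , 1 , # 4) ∷
     (2 , 3 , # 1) ∷ (3 , 2 , # 3) ∷ [])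
  three : ∀ v → v ≢ # 4 → Neighbours K4⁺ v 3
  three fz _ = neighbours₃ K4⁺ (# 4) (# 2) (# 3) tt tt tt (λ ()) (λ ()) (λ ())
  three (fs fz) _ = neighbours₃ K4⁺ (# 4) (# 2) (# 3) tt tt tt (λ ()) (λ ()) (λ ())
  three (fs (fs fz)) _ = neighbours₃ K4⁺ (# 0) (# 1) (# 3) tt tt tt (λ ()) (λ ()) (λ ())
  three (fs (fs (fs fz))) _ = neighbours₃ K4⁺ (# 0) (# 1) (# 2) tt tt tt (λ ()) (λ ()) (λ ())
  three (fs (fs (fs (fs fz)))) v≢4 = ⊥-elim (v≢4 refl)

enumeration-↔ : ∀ {A B : Set} → A ↔ B → Enumeration A → Enumeration B
enumeration-↔ bij e = record
  { elements = map to elements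
  ; unique = Unique.map⁺ to-injective unique
  ; complete = λ b → subst (_∈ map to elements) (strictlyInverseˡ b) (∈.∈-map⁺ to (complete (from b)))
  }
  where
  open Inverse bij
  open Enumeration e
  to-injective : ∀ {a a′} → to a ≡ to a′ → a ≡ a′
  to-injective {a} {a′} eq = trans (sym (strictlyInverseʳ a)) (trans (cong from eq) (strictlyInverseʳ a′))

admissible-≅ : ∀ {G H} → Admissible G → G ≅ H → Admissible H
admissible-≅ {G} {H} g G≅H = record
  { symmetric = symmetricH
  ; irreflexive = λ a t → irreflexive (from a) (adj-from a a t)
  ; enumeration = enumeration-↔ bij enumeration
  ; odd-order = subst Odd (sym (List.length-map to (Enumeration.elements enumeration))) odd-order
  ; exceptional = to exceptional
  ; exceptional-neighbour = transport exceptional exceptional-neighbour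
  ; three-neighbours = λ v v≢ → subst (λ w → Neighbours H w 3) (strictlyInverseˡ v)
      (transport (from v) (three-neighbours (from v) (λ e → v≢ (trans (sym (strictlyInverseˡ v)) (cong to e)))))
  ; colouring = λ a b → colouring (from a) (from b)
  ; conflictFree = λ w → conflictFreeAt-pullback H G _ colouring w (from w) from symmetricH symmetric
      (λ y → adj-from w y) (λ _ _ → refl) (λ _ _ → refl)
      (λ y y′ _ _ e → trans (sym (strictlyInverseˡ y)) (trans (cong to e) (strictlyInverseˡ y′)))
      (conflictFree (from w))
  }
  where
  open Admissible g
  open _≅_ G≅H
  open Inverse bij
  adj-from : ∀ a b → Adj H a b → Adj G (from a) (from b)
  adj-from a b = subst T (trans (cong₂ (adj H) (sym (strictlyInverseˡ a)) (sym (strictlyInverseˡ b)))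
                                (preserve (from a) (from b)))
  adj-to : ∀ a b → Adj G a b → Adj H (to a) (to b)
  adj-to a b = subst T (sym (preserve a b))
  symmetricH : IsSymmetric H
  symmetricH a b t = subst₂ (Adj H) (strictlyInverseˡ b) (strictlyInverseˡ a)
                       (adj-to _ _ (symmetric _ _ (adj-from a b t)))
  transport : ∀ {k} v → Neighbours G v k → Neighbours H (to v) k
  transport v = neighbours-transport H G (to v) v (λ u _ → to u) (λ u a → adj-to v u a) from
                  (λ u _ → strictlyInverseʳ u)

-- Gluing a gadget into a graph

-- O arises from G by cutting the incidences z₁ρ and z₂σ; every other adjacency of G is kept.
record Cut (G O : Graph) : Set where
  field
    embed           : V O → V G
    embed-injective : ∀ {a b} → embed a ≡ embed b → a ≡ b
    embed-adj       : ∀ a b → Adj O a b → Adj G (embed a) (embed b)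
    symmetric       : IsSymmetric O
    irreflexive     : IsIrreflexive O
    z₁ z₂           : V O
    z₁≢z₂           : z₁ ≢ z₂
    ρ σ             : V G
    z₁ρ             : Adj G (embed z₁) ρ
    z₂σ             : Adj G (embed z₂) σ
    ρ-cut           : ∀ n → Adj O z₁ n → embed n ≢ ρ
    σ-cut           : ∀ n → Adj O z₂ n → embed n ≢ σ
    lift            : ∀ a n → Adj G (embed a) n →
                      (a ≡ z₁ × n ≡ ρ) ⊎ (a ≡ z₂ × n ≡ σ) ⊎ Σ (V O) λ n′ → embed n′ ≡ n × Adj O a n′

record Gadget (W : Graph) (p q : V W) : Set where
  field
    p≢q          : p ≢ q
    symmetric    : IsSymmetric W
    irreflexive  : IsIrreflexive W
    p′ q′        : V W
    p-adj        : Adj W p p′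
    q-adj        : Adj W q q′
    p-leaf       : ∀ b → Adj W p b → b ≡ p′
    q-leaf       : ∀ b → Adj W q b → b ≡ q′
    p′≢q         : p′ ≢ q
    q′≢p         : q′ ≢ p
    colouring    : V W → V W → Fin 7
    conflictFree : ∀ x → x ≢ p → x ≢ q → ConflictFreeAt W colouring x

gadget-recolour : ∀ {W p q} → Gadget W p q → (π : Fin 7 → Fin 7) → (∀ {a b} → π a ≡ π b → a ≡ b) → Gadget W p q
gadget-recolour gad π π-inj = record gad
  { colouring = λ a b → π (colouring a b)
  ; conflictFree = λ x x≢p x≢q → conflictFreeAt-relabel _ colouring π π-inj x (conflictFree x x≢p x≢q)
  }
  where open Gadget gad

module Glue
  {G O W : Graph} (g : Admissible G) (cut : Cut G O) {p q : V W} (gad : Gadget W p q)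
  (out₁ : Gadget.colouring gad p (Gadget.p′ gad) ≡ Admissible.colouring g (Cut.embed cut (Cut.z₁ cut)) (Cut.ρ cut))
  (in₁  : Gadget.colouring gad (Gadget.p′ gad) p ≡ Admissible.colouring g (Cut.ρ cut) (Cut.embed cut (Cut.z₁ cut)))
  (out₂ : Gadget.colouring gad q (Gadget.q′ gad) ≡ Admissible.colouring g (Cut.embed cut (Cut.z₂ cut)) (Cut.σ cut))
  (in₂  : Gadget.colouring gad (Gadget.q′ gad) q ≡ Admissible.colouring g (Cut.σ cut) (Cut.embed cut (Cut.z₂ cut)))
  where

  open Admissible g using (colouring; conflictFree) renaming (symmetric to symmetricG)
  open Cut cut renaming (symmetric to symmetricO; irreflexive to irreflexiveO)
  open Gadget gad renaming (colouring to colouringW; conflictFree to conflictFreeW;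
                            symmetric to symmetricW; irreflexive to irreflexiveW)

  G′ : Graph
  G′ = glue O z₁ z₂ W p q

  I = Inner W p q

  inner : ∀ x → x ≢ p → x ≢ q → I
  inner x x≢p x≢q = x , Equivalence.from T-not
    ([ x≢p ∘ toWitness {a? = (_≟_ W) x p} , x≢q ∘ toWitness {a? = (_≟_ W) x q} ]′ ∘ Equivalence.to T-∨)

  inner-≢p : (x : I) → proj₁ x ≢ p
  inner-≢p (x , t) e = Equivalence.to T-not t (Equivalence.from T-∨ (inj₁ (fromWitness {a? = (_≟_ W) x p} e)))

  inner-≢q : (x : I) → proj₁ x ≢ q
  inner-≢q (x , t) e = Equivalence.to T-not t (Equivalence.from (T-∨ {⌊ (_≟_ W) x p ⌋}) (inj₂ (fromWitness e)))

  attached⁻ : ∀ a (x : I) → Adj G′ (inj₁ a) (inj₂ x) → (a ≡ z₁ × Adj W p (proj₁ x)) ⊎ (a ≡ z₂ × Adj W q (proj₁ x))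
  attached⁻ a x t with Equivalence.to (T-∨ {⌊ (_≟_ O) a z₁ ⌋ ∧ adj W p (proj₁ x)}) t
  ... | inj₁ u = let (e , s) = Equivalence.to T-∧ u in inj₁ (toWitness e , s)
  ... | inj₂ u = let (e , s) = Equivalence.to T-∧ u in inj₂ (toWitness e , s)

  attached⁺ : ∀ a (x : I) → (a ≡ z₁ × Adj W p (proj₁ x)) ⊎ (a ≡ z₂ × Adj W q (proj₁ x)) → Adj G′ (inj₁ a) (inj₂ x)
  attached⁺ a x (inj₁ (e , s)) =
    Equivalence.from T-∨ (inj₁ (Equivalence.from T-∧ (fromWitness {a? = (_≟_ O) a z₁} e , s)))
  attached⁺ a x (inj₂ (e , s)) =
    Equivalence.from (T-∨ {⌊ (_≟_ O) a z₁ ⌋ ∧ adj W p (proj₁ x)}) (inj₂ (Equivalence.from T-∧ (fromWitness e , s)))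

  onZ₁ : {X : Set} → X → X → V O → X
  onZ₁ at-z₁ elsewhere a with (_≟_ O) a z₁
  ... | yes _ = at-z₁
  ... | no _ = elsewhere

  onZ₁-z₁ : {X : Set} (x y : X) → onZ₁ x y z₁ ≡ x
  onZ₁-z₁ x y with (_≟_ O) z₁ z₁
  ... | yes _ = refl
  ... | no z₁≢z₁ = ⊥-elim (z₁≢z₁ refl)

  onZ₁-z₂ : {X : Set} (x y : X) → onZ₁ x y z₂ ≡ y
  onZ₁-z₂ x y with (_≟_ O) z₂ z₁
  ... | yes z₂≡z₁ = ⊥-elim (z₁≢z₂ (sym z₂≡z₁))
  ... | no _ = refl

  -- An old vertex adjacent to the gadget plays the role of the terminal it replaces.
  terminal : V O → V W
  terminal = onZ₁ p q

  cutEnd : V O → V G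
  cutEnd = onZ₁ ρ σ

  colouring′ : V G′ → V G′ → Fin 7
  colouring′ (inj₁ a) (inj₁ b) = colouring (embed a) (embed b)
  colouring′ (inj₂ x) (inj₂ y) = colouringW (proj₁ x) (proj₁ y)
  colouring′ (inj₁ a) (inj₂ y) = colouringW (terminal a) (proj₁ y)
  colouring′ (inj₂ x) (inj₁ a) = colouringW (proj₁ x) (terminal a)

  symmetric′ : IsSymmetric G′
  symmetric′ (inj₁ a) (inj₁ b) t = symmetricO a b t
  symmetric′ (inj₂ x) (inj₂ y) t = symmetricW _ _ t
  symmetric′ (inj₁ a) (inj₂ y) t = t
  symmetric′ (inj₂ x) (inj₁ b) t = t

  irreflexive′ : IsIrreflexive G′
  irreflexive′ (inj₁ a) = irreflexiveO a
  irreflexive′ (inj₂ x) = irreflexiveW _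

  p′-inner : I
  p′-inner = inner p′ (λ e → irreflexiveW p (subst (Adj W p) e p-adj)) p′≢q

  q′-inner : I
  q′-inner = inner q′ q′≢p (λ e → irreflexiveW q (subst (Adj W q) e q-adj))

  -- Seen from an old vertex a, the gadget collapses onto the cut end of a.
  toG : V O → V G′ → V G
  toG a (inj₁ n) = embed n
  toG a (inj₂ _) = cutEnd a

  conflictFree-old : ∀ a → ConflictFreeAt G′ colouring′ (inj₁ a)
  conflictFree-old a = conflictFreeAt-pullback G′ G colouring′ colouring (inj₁ a) (embed a) (toG a)
    symmetric′ symmetricG adj≡ out≡ in≡ toG-inj (conflictFree (embed a))
    where
    adj≡ : ∀ y → Adj G′ (inj₁ a) y → Adj G (embed a) (toG a y)
    adj≡ (inj₁ n) t = embed-adj a n t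
    adj≡ (inj₂ w) t with attached⁻ a w t
    ... | inj₁ (refl , _) = subst (Adj G (embed z₁)) (sym (onZ₁-z₁ ρ σ)) z₁ρ
    ... | inj₂ (refl , _) = subst (Adj G (embed z₂)) (sym (onZ₁-z₂ ρ σ)) z₂σ
    out≡ : ∀ y → Adj G′ (inj₁ a) y → colouring′ (inj₁ a) y ≡ colouring (embed a) (toG a y)
    out≡ (inj₁ n) t = refl
    out≡ (inj₂ w) t with attached⁻ a w t
    ... | inj₁ (refl , s) rewrite onZ₁-z₁ p q | onZ₁-z₁ ρ σ | p-leaf _ s = out₁
    ... | inj₂ (refl , s) rewrite onZ₁-z₂ p q | onZ₁-z₂ ρ σ | q-leaf _ s = out₂
    in≡ : ∀ y → Adj G′ (inj₁ a) y → colouring′ y (inj₁ a) ≡ colouring (toG a y) (embed a)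
    in≡ (inj₁ n) t = refl
    in≡ (inj₂ w) t with attached⁻ a w t
    ... | inj₁ (refl , s) rewrite onZ₁-z₁ p q | onZ₁-z₁ ρ σ | p-leaf _ s = in₁
    ... | inj₂ (refl , s) rewrite onZ₁-z₂ p q | onZ₁-z₂ ρ σ | q-leaf _ s = in₂
    toG-inj : ∀ y y′ → Adj G′ (inj₁ a) y → Adj G′ (inj₁ a) y′ → toG a y ≡ toG a y′ → y ≡ y′
    toG-inj (inj₁ n) (inj₁ n′) t t′ e = cong inj₁ (embed-injective e)
    toG-inj (inj₁ n) (inj₂ w) t t′ e with attached⁻ a w t′
    ... | inj₁ (refl , _) = ⊥-elim (ρ-cut n t (trans e (onZ₁-z₁ ρ σ)))
    ... | inj₂ (refl , _) = ⊥-elim (σ-cut n t (trans e (onZ₁-z₂ ρ σ)))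
    toG-inj (inj₂ w) (inj₁ n) t t′ e with attached⁻ a w t
    ... | inj₁ (refl , _) = ⊥-elim (ρ-cut n t′ (trans (sym e) (onZ₁-z₁ ρ σ)))
    ... | inj₂ (refl , _) = ⊥-elim (σ-cut n t′ (trans (sym e) (onZ₁-z₂ ρ σ)))
    toG-inj (inj₂ w) (inj₂ w′) t t′ e with attached⁻ a w t | attached⁻ a w′ t′
    ... | inj₁ (refl , s) | inj₁ (_ , s′) = cong inj₂ (Σ-≡ (trans (p-leaf _ s) (sym (p-leaf _ s′))))
    ... | inj₂ (refl , s) | inj₂ (_ , s′) = cong inj₂ (Σ-≡ (trans (q-leaf _ s) (sym (q-leaf _ s′))))
    ... | inj₁ (refl , _) | inj₂ (z₁≡z₂ , _) = ⊥-elim (z₁≢z₂ z₁≡z₂)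
    ... | inj₂ (refl , _) | inj₁ (z₂≡z₁ , _) = ⊥-elim (z₁≢z₂ (sym z₂≡z₁))

  toW : V G′ → V W
  toW (inj₁ b) = terminal b
  toW (inj₂ y) = proj₁ y

  conflictFree-inner : ∀ x → ConflictFreeAt G′ colouring′ (inj₂ x)
  conflictFree-inner x = conflictFreeAt-pullback G′ W colouring′ colouringW (inj₂ x) (proj₁ x) toW
    symmetric′ symmetricW adj≡
    (λ { (inj₁ _) _ → refl ; (inj₂ _) _ → refl }) (λ { (inj₁ _) _ → refl ; (inj₂ _) _ → refl })
    toW-inj (conflictFreeW (proj₁ x) (inner-≢p x) (inner-≢q x))
    where
    adj≡ : ∀ y → Adj G′ (inj₂ x) y → Adj W (proj₁ x) (toW y)
    adj≡ (inj₂ y) t = t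
    adj≡ (inj₁ b) t with attached⁻ b x t
    ... | inj₁ (refl , s) = subst (Adj W (proj₁ x)) (sym (onZ₁-z₁ p q)) (symmetricW _ _ s)
    ... | inj₂ (refl , s) = subst (Adj W (proj₁ x)) (sym (onZ₁-z₂ p q)) (symmetricW _ _ s)
    toW-inj : ∀ y y′ → Adj G′ (inj₂ x) y → Adj G′ (inj₂ x) y′ → toW y ≡ toW y′ → y ≡ y′
    toW-inj (inj₂ y) (inj₂ y′) t t′ e = cong inj₂ (Σ-≡ e)
    toW-inj (inj₁ b) (inj₂ y) t t′ e with attached⁻ b x t
    ... | inj₁ (refl , _) = ⊥-elim (inner-≢p y (sym (trans (sym (onZ₁-z₁ p q)) e)))
    ... | inj₂ (refl , _) = ⊥-elim (inner-≢q y (sym (trans (sym (onZ₁-z₂ p q)) e)))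
    toW-inj (inj₂ y) (inj₁ b) t t′ e with attached⁻ b x t′
    ... | inj₁ (refl , _) = ⊥-elim (inner-≢p y (trans e (onZ₁-z₁ p q)))
    ... | inj₂ (refl , _) = ⊥-elim (inner-≢q y (trans e (onZ₁-z₂ p q)))
    toW-inj (inj₁ b) (inj₁ b′) t t′ e with attached⁻ b x t | attached⁻ b′ x t′
    ... | inj₁ (refl , _) | inj₁ (refl , _) = refl
    ... | inj₂ (refl , _) | inj₂ (refl , _) = refl
    ... | inj₁ (refl , _) | inj₂ (refl , _) = ⊥-elim (p≢q (trans (sym (onZ₁-z₁ p q)) (trans e (onZ₁-z₂ p q))))
    ... | inj₂ (refl , _) | inj₁ (refl , _) = ⊥-elim (p≢q (trans (sym (onZ₁-z₁ p q)) (trans (sym e) (onZ₁-z₂ p q))))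

  conflictFree′ : ∀ w → ConflictFreeAt G′ colouring′ w
  conflictFree′ (inj₁ a) = conflictFree-old a
  conflictFree′ (inj₂ x) = conflictFree-inner x

  old-neighbour : ∀ a n → Adj G (embed a) n → Σ (V G′) λ y → Adj G′ (inj₁ a) y × toG a y ≡ n
  old-neighbour a n t with lift a n t
  ... | inj₁ (refl , refl) = inj₂ p′-inner , attached⁺ z₁ p′-inner (inj₁ (refl , p-adj)) , onZ₁-z₁ ρ σ
  ... | inj₂ (inj₁ (refl , refl)) = inj₂ q′-inner , attached⁺ z₂ q′-inner (inj₂ (refl , q-adj)) , onZ₁-z₂ ρ σ
  ... | inj₂ (inj₂ (n′ , refl , t′)) = inj₁ n′ , t′ , refl

  old-neighbours : ∀ {k} a → Neighbours G (embed a) k → Neighbours G′ (inj₁ a) k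
  old-neighbours a = neighbours-transport G′ G (inj₁ a) (embed a) (λ n t → proj₁ (old-neighbour a n t))
    (λ n t → proj₁ (proj₂ (old-neighbour a n t))) (toG a) (λ n t → proj₂ (proj₂ (old-neighbour a n t)))

  inner-neighbour : ∀ x b → Adj W (proj₁ x) b → Σ (V G′) λ y → Adj G′ (inj₂ x) y × toW y ≡ b
  inner-neighbour x b t with (_≟_ W) b p | (_≟_ W) b q
  ... | yes refl | _ = inj₁ z₁ , attached⁺ z₁ x (inj₁ (refl , symmetricW _ _ t)) , onZ₁-z₁ p q
  ... | no _ | yes refl = inj₁ z₂ , attached⁺ z₂ x (inj₂ (refl , symmetricW _ _ t)) , onZ₁-z₂ p q
  ... | no b≢p | no b≢q = inj₂ (inner b b≢p b≢q) , t , refl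

  inner-neighbours : ∀ {k} x → Neighbours W (proj₁ x) k → Neighbours G′ (inj₂ x) k
  inner-neighbours x = neighbours-transport G′ W (inj₂ x) (proj₁ x) (λ n t → proj₁ (inner-neighbour x n t))
    (λ n t → proj₁ (proj₂ (inner-neighbour x n t))) toW (λ n t → proj₂ (proj₂ (inner-neighbour x n t)))

  admissible′ : (eO : Enumeration (V O)) (eI : Enumeration I)
    → Odd (Enumeration.size eO + Enumeration.size eI)
    → (d : V G′) → Neighbours G′ d 1 → (∀ v → v ≢ d → Neighbours G′ v 3) → Admissible G′
  admissible′ eO eI odd d d-nb three = record
    { symmetric = symmetric′
    ; irreflexive = irreflexive′
    ; enumeration = sumEnumeration eO eI
    ; odd-order = subst Odd (sym (size-sumEnumeration eO eI)) odd
    ; exceptional = d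
    ; exceptional-neighbour = d-nb
    ; three-neighbours = three
    ; colouring = colouring′
    ; conflictFree = conflictFree′
    }

-- Replacing a vertex of degree 2

no-three-neighbours-among-two : ∀ (G : Graph) {z} z₁ z₂ → (∀ w → Adj G z w → w ≡ z₁ ⊎ w ≡ z₂) → ¬ Neighbours G z 3
no-three-neighbours-among-two G z₁ z₂ only nb =
  let i , j , i<j , same = Fin.pigeonhole (ℕ.n<1+n 2) (side ∘ only′)
  in Fin.<-irrefl (injective (same-side (only′ i) (only′ j) same)) i<j
  where
  open Neighbours nb
  side : ∀ {a} → a ≡ z₁ ⊎ a ≡ z₂ → Fin 2
  side = [ (λ _ → fz) , (λ _ → fs fz) ]′
  only′ : ∀ i → neighbour i ≡ z₁ ⊎ neighbour i ≡ z₂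
  only′ i = only (neighbour i) (adjacent i)
  same-side : ∀ {a b} (ea : a ≡ z₁ ⊎ a ≡ z₂) (eb : b ≡ z₁ ⊎ b ≡ z₂) → side ea ≡ side eb → a ≡ b
  same-side (inj₁ refl) (inj₁ refl) _ = refl
  same-side (inj₂ refl) (inj₂ refl) _ = refl
  same-side (inj₁ _) (inj₂ _) ()
  same-side (inj₂ _) (inj₁ _) ()

module _ (G : Graph) (z : V G) where

  deleted-≢ : (v : V (deleteVertex G z)) → proj₁ v ≢ z
  deleted-≢ (v , t) = Equivalence.to T-not t ∘ fromWitness {a? = (_≟_ G) v z}

  kept : ∀ v → v ≢ z → V (deleteVertex G z)
  kept v v≢z = v , Equivalence.from T-not (v≢z ∘ toWitness {a? = (_≟_ G) v z})

  size-deleteVertex : (e : Enumeration (V G)) →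
    suc (Enumeration.size (subtypeEnumeration (λ v → not ⌊ (_≟_ G) v z ⌋) e)) ≡ Enumeration.size e
  size-deleteVertex e = begin
    suc (Enumeration.size (subtypeEnumeration P e))    ≡⟨ cong suc (size-subtypeEnumeration P e) ⟩
    suc (length (filter (T? ∘ P) elements))           ≡⟨ ℕ.+-comm 1 _ ⟩
    length (filter (T? ∘ P) elements) + 1             ≡⟨ length-filter+rejected (_≟_ G) (T? ∘ P) elements (z ∷ [])
                                                           unique ([] ∷ []) rejected cover ⟩
    length elements                                   ∎
    where
    open ≡-Reasoning
    open Enumeration e
    P : V G → Bool
    P v = not ⌊ (_≟_ G) v z ⌋
    rejected : ∀ {y} → y ∈ z ∷ [] → y ∈ elements × ¬ T (P y)
    rejected (here refl) = complete z , λ t → deleted-≢ (z , t) refl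
    cover : ∀ {x} → x ∈ elements → T (P x) ⊎ x ∈ z ∷ []
    cover {x} _ with (_≟_ G) x z
    ... | yes refl = inj₂ (here refl)
    ... | no _ = inj₁ tt

size-Inner : (W : Graph) (p q : V W) → p ≢ q → (e : Enumeration (V W)) →
  suc (suc (Enumeration.size (subtypeEnumeration (λ w → not (⌊ (_≟_ W) w p ⌋ ∨ ⌊ (_≟_ W) w q ⌋)) e)))
    ≡ Enumeration.size e
size-Inner W p q p≢q e = begin
  2 + Enumeration.size (subtypeEnumeration P e)  ≡⟨ cong (2 +_) (size-subtypeEnumeration P e) ⟩
  2 + length (filter (T? ∘ P) elements)          ≡⟨ ℕ.+-comm 2 _ ⟩
  length (filter (T? ∘ P) elements) + 2          ≡⟨ length-filter+rejected (_≟_ W) (T? ∘ P) elements (p ∷ q ∷ [])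
                                                      unique ((p≢q ∷ []) ∷ [] ∷ []) rejected cover ⟩
  length elements                                ∎
  where
  open ≡-Reasoning
  open Enumeration e
  P : V W → Bool
  P w = not (⌊ (_≟_ W) w p ⌋ ∨ ⌊ (_≟_ W) w q ⌋)
  rejected : ∀ {y} → y ∈ p ∷ q ∷ [] → y ∈ elements × ¬ T (P y)
  rejected (here refl) = complete p , λ t →
    Equivalence.to T-not t (Equivalence.from T-∨ (inj₁ (fromWitness {a? = (_≟_ W) p p} refl)))
  rejected (there (here refl)) = complete q , λ t →
    Equivalence.to T-not t (Equivalence.from (T-∨ {⌊ (_≟_ W) q p ⌋}) (inj₂ (fromWitness {a? = (_≟_ W) q q} refl)))
  cover : ∀ {x} → x ∈ elements → T (P x) ⊎ x ∈ p ∷ q ∷ []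
  cover {x} _ with (_≟_ W) x p | (_≟_ W) x q
  ... | yes refl | _ = inj₂ (here refl)
  ... | no _ | yes refl = inj₂ (there (here refl))
  ... | no _ | no _ = inj₁ tt

record Deg2Gadget (W : Graph) (p q : V W) : Set where
  field
    gadget : Gadget W p q
  open Gadget gadget public
  field
    colour-p  : colouring p p′ ≡ # 0
    colour-p′ : colouring p′ p ≡ # 1
    colour-q  : colouring q q′ ≡ # 2
    colour-q′ : colouring q′ q ≡ # 3
    inner-enumeration : Enumeration (Inner W p q)
    inner-odd         : Odd (Enumeration.size inner-enumeration)
    exceptional       : V W
    exceptional-≢p    : exceptional ≢ p
    exceptional-≢q    : exceptional ≢ q
    exceptional-neighbour : Neighbours W exceptional 1
    three-neighbours  : ∀ x → x ≢ p → x ≢ q → x ≢ exceptional → Neighbours W x 3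

cut-deleteVertex : ∀ {G} → IsSymmetric G → IsIrreflexive G → (z z₁ z₂ : V G) → Degree2 G z z₁ z₂
  → (h₁ : T (not ⌊ (_≟_ G) z₁ z ⌋)) (h₂ : T (not ⌊ (_≟_ G) z₂ z ⌋)) → Cut G (deleteVertex G z)
cut-deleteVertex {G} symmetric irreflexive z z₁ z₂ (z₁≢z₂ , zz₁ , zz₂ , only) h₁ h₂ = record
  { embed = proj₁ ; embed-injective = Σ-≡ ; embed-adj = λ _ _ t → t
  ; symmetric = λ a b → symmetric (proj₁ a) (proj₁ b)
  ; irreflexive = λ a → irreflexive (proj₁ a)
  ; z₁ = z₁ , h₁ ; z₂ = z₂ , h₂ ; z₁≢z₂ = z₁≢z₂ ∘ cong proj₁
  ; ρ = z ; σ = z ; z₁ρ = symmetric z z₁ zz₁ ; z₂σ = symmetric z z₂ zz₂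
  ; ρ-cut = λ n _ → deleted-≢ G z n ; σ-cut = λ n _ → deleted-≢ G z n
  ; lift = lift
  }
  where
  O = deleteVertex G z
  lift : ∀ (a : V O) n → Adj G (proj₁ a) n →
    (a ≡ (z₁ , h₁) × n ≡ z) ⊎ (a ≡ (z₂ , h₂) × n ≡ z) ⊎ Σ (V O) λ n′ → proj₁ n′ ≡ n × Adj O a n′
  lift a n t with (_≟_ G) n z
  ... | no n≢z = inj₂ (inj₂ (kept G z n n≢z , refl , t))
  ... | yes refl with only (proj₁ a) (symmetric _ _ t)
  ...   | inj₁ a≡z₁ = inj₁ (Σ-≡ a≡z₁ , refl)
  ...   | inj₂ a≡z₂ = inj₂ (inj₁ (Σ-≡ a≡z₂ , refl))

-- The four incidences at a vertex of degree 2 pairwise conflict.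
degree2-colours-unique : ∀ {G} (g : Admissible G) {z z₁ z₂} → Degree2 G z z₁ z₂ →
  let open Admissible g in
  Unique (colouring z₁ z ∷ colouring z z₁ ∷ colouring z₂ z ∷ colouring z z₂ ∷ [])
degree2-colours-unique g {z} {z₁} {z₂} (z₁≢z₂ , zz₁ , zz₂ , _) =
  (≢-sym (out-in z₁ z₁ zz₁ z₁z) ∷ in-in z₁ z₂ z₁z z₂z z₁≢z₂ ∷ ≢-sym (out-in z₂ z₁ zz₂ z₁z) ∷ [])
  ∷ (out-in z₁ z₂ zz₁ z₂z ∷ out-out z₁ z₂ zz₁ zz₂ z₁≢z₂ ∷ [])
  ∷ (≢-sym (out-in z₂ z₂ zz₂ z₂z) ∷ []) ∷ [] ∷ []
  where
  open Admissible g
  open ConflictFreeAt (conflictFree z)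
  z₁z = symmetric z z₁ zz₁
  z₂z = symmetric z z₂ zz₂

admissible-replaceDeg2 : ∀ {G} → Admissible G → (z z₁ z₂ : V G) → Degree2 G z z₁ z₂
  → (h₁ : T (not ⌊ (_≟_ G) z₁ z ⌋)) (h₂ : T (not ⌊ (_≟_ G) z₂ z ⌋))
  → ∀ {W p q} → Deg2Gadget W p q → Admissible (replaceDeg2 G z z₁ z₂ h₁ h₂ W p q)
admissible-replaceDeg2 {G} g z z₁ z₂ deg2@(_ , _ , _ , only) h₁ h₂ {W} {p} {q} gad =
  Glued.admissible′ eO inner-enumeration odd (inj₂ d′) (Glued.inner-neighbours d′ exceptional-neighbour) three
  where
  open Admissible g using (symmetric; irreflexive; colouring; enumeration; odd-order)
  open Deg2Gadget gad using (inner-enumeration; inner-odd; exceptional-neighbour; exceptional-≢p; exceptional-≢q)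
  sending = injection-sending
    ((# 0 , colouring z₁ z) ∷ (# 1 , colouring z z₁) ∷ (# 2 , colouring z₂ z) ∷ (# 3 , colouring z z₂) ∷ [])
    (((λ ()) ∷ (λ ()) ∷ (λ ()) ∷ []) ∷ ((λ ()) ∷ (λ ()) ∷ []) ∷ ((λ ()) ∷ []) ∷ [] ∷ [])
    (degree2-colours-unique g deg2)
  π = proj₁ sending
  sent = All.lookup (proj₂ (proj₂ sending))
  module Glued = Glue g (cut-deleteVertex symmetric irreflexive z z₁ z₂ deg2 h₁ h₂)
    (gadget-recolour (Deg2Gadget.gadget gad) π (proj₁ (proj₂ sending)))
    (trans (cong π (Deg2Gadget.colour-p gad)) (sent (here refl)))
    (trans (cong π (Deg2Gadget.colour-p′ gad)) (sent (there (here refl))))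
    (trans (cong π (Deg2Gadget.colour-q gad)) (sent (there (there (here refl)))))
    (trans (cong π (Deg2Gadget.colour-q′ gad)) (sent (there (there (there (here refl))))))
  eO : Enumeration (V (deleteVertex G z))
  eO = subtypeEnumeration (λ v → not ⌊ (_≟_ G) v z ⌋) enumeration
  odd : Odd (Enumeration.size eO + Enumeration.size inner-enumeration)
  odd = oddSuc+odd (subst Odd (sym (size-deleteVertex G z enumeration)) odd-order) inner-odd
  z≡exceptional : z ≡ Admissible.exceptional g
  z≡exceptional with (_≟_ G) z (Admissible.exceptional g)
  ... | yes e = e
  ... | no z≢ = ⊥-elim (no-three-neighbours-among-two G z₁ z₂ only (Admissible.three-neighbours g z z≢))
  d′ : Inner W p q
  d′ = Glued.inner (Deg2Gadget.exceptional gad) exceptional-≢p exceptional-≢q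
  three : ∀ v → v ≢ inj₂ d′ → Neighbours Glued.G′ v 3
  three (inj₁ a) _ = Glued.old-neighbours a
    (Admissible.three-neighbours g (proj₁ a) (λ e → deleted-≢ G z a (trans e (sym z≡exceptional))))
  three (inj₂ x) x≢d′ = Glued.inner-neighbours x (Deg2Gadget.three-neighbours gad (proj₁ x)
    (Glued.inner-≢p x) (Glued.inner-≢q x) (λ e → x≢d′ (cong inj₂ (Σ-≡ e))))

module _ (m : ℕ) (es : List (ℕ × ℕ)) where

  leaf? : (p p′ : Fin m) → Dec (∀ b → Adj (edgeGraph m es) p b → b ≡ p′)
  leaf? p p′ = Fin.all? λ b → T? (adj (edgeGraph m es) p b) →-dec (b Fin.≟ p′)

  -- All side conditions on a concrete gadget are closed decidable statements, discharged by evaluation.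
  edgeGraphGadget : (p q p′ q′ : Fin m) (c : Fin m → Fin m → Fin 7)
    → {True (¬? (p Fin.≟ q))} → {True (irreflexive? m es)}
    → {Adj (edgeGraph m es) p p′} → {Adj (edgeGraph m es) q q′}
    → {True (leaf? p p′)} → {True (leaf? q q′)}
    → {True (¬? (p′ Fin.≟ q))} → {True (¬? (q′ Fin.≟ p))}
    → {True (Fin.all? (conflictFreeAt? m es c))}
    → Gadget (edgeGraph m es) p q
  edgeGraphGadget p q p′ q′ c {p≢q} {irr} {pp′} {qq′} {p-leaf} {q-leaf} {p′≢q} {q′≢p} {cf} = record
    { p≢q = toWitness p≢q ; symmetric = edgeGraph-symmetric m es ; irreflexive = toWitness irr
    ; p′ = p′ ; q′ = q′ ; p-adj = pp′ ; q-adj = qq′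
    ; p-leaf = toWitness p-leaf ; q-leaf = toWitness q-leaf
    ; p′≢q = toWitness p′≢q ; q′≢p = toWitness q′≢p
    ; colouring = c ; conflictFree = λ x _ _ → toWitness cf x
    }

G₂-gadget : Deg2Gadget G₂ G₂x G₂y
G₂-gadget = record
  { gadget = edgeGraphGadget 5 edges (# 3) (# 4) (# 1) (# 2) colouring
  ; colour-p = refl ; colour-p′ = refl ; colour-q = refl ; colour-q′ = refl
  ; inner-enumeration = inner
  ; inner-odd = toWitnessFalse {a? = 2 ∣? Enumeration.size inner} tt
  ; exceptional = # 0 ; exceptional-≢p = λ () ; exceptional-≢q = λ ()
  ; exceptional-neighbour = neighbours₁ G₂ (# 1) tt
  ; three-neighbours = three
  }
  where
  edges = (0 , 1) ∷ (0 , 2) ∷ (1 , 2) ∷ (1 , 3) ∷ (2 , 4) ∷ []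
  colouring : Fin 5 → Fin 5 → Fin 7
  colouring = colourTable
    ((3 , 1 , # 0) ∷ (1 , 3 , # 1) ∷ (4 , 2 , # 2) ∷ (2 , 4 , # 3) ∷ (0 , 1 , # 2) ∷ (1 , 0 , # 3) ∷
     (0 , 2 , # 0) ∷ (2 , 0 , # 1) ∷ (1 , 2 , # 4) ∷ (2 , 1 , # 5) ∷ [])
  inner = subtypeEnumeration _ (allFinEnumeration 5)
  three : ∀ x → x ≢ # 3 → x ≢ # 4 → x ≢ # 0 → Neighbours G₂ x 3
  three fz _ _ x≢0 = ⊥-elim (x≢0 refl)
  three (fs fz) _ _ _ = neighbours₃ G₂ (# 0) (# 2) (# 3) tt tt tt (λ ()) (λ ()) (λ ())
  three (fs (fs fz)) _ _ _ = neighbours₃ G₂ (# 0) (# 1) (# 4) tt tt tt (λ ()) (λ ()) (λ ())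
  three (fs (fs (fs fz))) x≢3 _ _ = ⊥-elim (x≢3 refl)
  three (fs (fs (fs (fs fz)))) _ x≢4 _ = ⊥-elim (x≢4 refl)

G₄-gadget : Deg2Gadget G₄ G₄x G₄y
G₄-gadget = record
  { gadget = edgeGraphGadget 7 edges (# 0) (# 1) (# 3) (# 5) colouring
  ; colour-p = refl ; colour-p′ = refl ; colour-q = refl ; colour-q′ = refl
  ; inner-enumeration = inner
  ; inner-odd = toWitnessFalse {a? = 2 ∣? Enumeration.size inner} tt
  ; exceptional = # 6 ; exceptional-≢p = λ () ; exceptional-≢q = λ ()
  ; exceptional-neighbour = neighbours₁ G₄ (# 2) tt
  ; three-neighbours = three
  }
  where
  edges = (0 , 3) ∷ (3 , 2) ∷ (3 , 4) ∷ (2 , 5) ∷ (2 , 6) ∷ (4 , 5) ∷ (4 , 6) ∷ (5 , 1) ∷ []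
  colouring : Fin 7 → Fin 7 → Fin 7
  colouring = colourTable
    ((0 , 3 , # 0) ∷ (3 , 0 , # 1) ∷ (1 , 5 , # 2) ∷ (5 , 1 , # 3) ∷ (3 , 2 , # 2) ∷ (2 , 3 , # 3) ∷
     (3 , 4 , # 4) ∷ (4 , 3 , # 5) ∷ (2 , 5 , # 0) ∷ (5 , 2 , # 4) ∷ (2 , 6 , # 1) ∷ (6 , 2 , # 5) ∷
     (4 , 5 , # 1) ∷ (5 , 4 , # 6) ∷ (4 , 6 , # 0) ∷ (6 , 4 , # 2) ∷ [])
  inner = subtypeEnumeration _ (allFinEnumeration 7)
  three : ∀ x → x ≢ # 0 → x ≢ # 1 → x ≢ # 6 → Neighbours G₄ x 3
  three fz x≢0 _ _ = ⊥-elim (x≢0 refl)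
  three (fs fz) _ x≢1 _ = ⊥-elim (x≢1 refl)
  three (fs (fs fz)) _ _ _ = neighbours₃ G₄ (# 3) (# 5) (# 6) tt tt tt (λ ()) (λ ()) (λ ())
  three (fs (fs (fs fz))) _ _ _ = neighbours₃ G₄ (# 0) (# 2) (# 4) tt tt tt (λ ()) (λ ()) (λ ())
  three (fs (fs (fs (fs fz)))) _ _ _ = neighbours₃ G₄ (# 3) (# 5) (# 6) tt tt tt (λ ()) (λ ()) (λ ())
  three (fs (fs (fs (fs (fs fz))))) _ _ _ = neighbours₃ G₄ (# 2) (# 4) (# 1) tt tt tt (λ ()) (λ ()) (λ ())
  three (fs (fs (fs (fs (fs (fs fz)))))) _ _ x≢6 = ⊥-elim (x≢6 refl)

G₈-gadget : Deg2Gadget G₈ G₈x G₈y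
G₈-gadget = record
  { gadget = edgeGraphGadget 7 edges (# 0) (# 1) (# 4) (# 6) colouring
  ; colour-p = refl ; colour-p′ = refl ; colour-q = refl ; colour-q′ = refl
  ; inner-enumeration = inner
  ; inner-odd = toWitnessFalse {a? = 2 ∣? Enumeration.size inner} tt
  ; exceptional = # 3 ; exceptional-≢p = λ () ; exceptional-≢q = λ ()
  ; exceptional-neighbour = neighbours₁ G₈ (# 4) tt
  ; three-neighbours = three
  }
  where
  edges = (0 , 4) ∷ (4 , 3) ∷ (4 , 5) ∷ (3 , 2) ∷ (2 , 5) ∷ (2 , 6) ∷ (5 , 6) ∷ (6 , 1) ∷ []
  colouring : Fin 7 → Fin 7 → Fin 7
  colouring = colourTable
    ((0 , 4 , # 0) ∷ (4 , 0 , # 1) ∷ (1 , 6 , # 2) ∷ (6 , 1 , # 3) ∷ (4 , 3 , # 2) ∷ (3 , 4 , # 3) ∷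
     (4 , 5 , # 4) ∷ (5 , 4 , # 5) ∷ (3 , 2 , # 0) ∷ (2 , 3 , # 1) ∷ (2 , 5 , # 2) ∷ (5 , 2 , # 3) ∷
     (2 , 6 , # 4) ∷ (6 , 2 , # 5) ∷ (5 , 6 , # 0) ∷ (6 , 5 , # 1) ∷ [])
  inner = subtypeEnumeration _ (allFinEnumeration 7)
  three : ∀ x → x ≢ # 0 → x ≢ # 1 → x ≢ # 3 → Neighbours G₈ x 3
  three fz x≢0 _ _ = ⊥-elim (x≢0 refl)
  three (fs fz) _ x≢1 _ = ⊥-elim (x≢1 refl)
  three (fs (fs fz)) _ _ _ = neighbours₃ G₈ (# 3) (# 5) (# 6) tt tt tt (λ ()) (λ ()) (λ ())
  three (fs (fs (fs fz))) _ _ x≢3 = ⊥-elim (x≢3 refl)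
  three (fs (fs (fs (fs fz)))) _ _ _ = neighbours₃ G₈ (# 0) (# 3) (# 5) tt tt tt (λ ()) (λ ()) (λ ())
  three (fs (fs (fs (fs (fs fz))))) _ _ _ = neighbours₃ G₈ (# 4) (# 2) (# 6) tt tt tt (λ ()) (λ ()) (λ ())
  three (fs (fs (fs (fs (fs (fs fz)))))) _ _ _ = neighbours₃ G₈ (# 2) (# 5) (# 1) tt tt tt (λ ()) (λ ()) (λ ())

-- Replacing an edge

module _ (G : Graph) (a b : V G) where

  private
    _≟G_ = _≟_ G

  both⁺ : ∀ {x y x′ y′} → x ≡ x′ × y ≡ y′ → T (⌊ x ≟G x′ ⌋ ∧ ⌊ y ≟G y′ ⌋)
  both⁺ {x} {y} {x′} {y′} (e , f) = Equivalence.from T-∧ (fromWitness {a? = x ≟G x′} e , fromWitness {a? = y ≟G y′} f)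

  both⁻ : ∀ {x y x′ y′} → T (⌊ x ≟G x′ ⌋ ∧ ⌊ y ≟G y′ ⌋) → x ≡ x′ × y ≡ y′
  both⁻ {x} {y} {x′} {y′} t with Equivalence.to T-∧ t
  ... | e , f = toWitness {a? = x ≟G x′} e , toWitness {a? = y ≟G y′} f

  deleteEdge-adj⁻ : ∀ {u v} → Adj (deleteEdge G a b) u v → Adj G u v × ¬ (u ≡ a × v ≡ b) × ¬ (u ≡ b × v ≡ a)
  deleteEdge-adj⁻ {u} {v} t with Equivalence.to (T-∧ {adj G u v}) t
  ... | uv , kept = uv , cut ∘ inj₁ ∘ both⁺ , cut ∘ inj₂ ∘ both⁺
    where
    cut = Equivalence.to T-not kept ∘ Equivalence.from (T-∨ {⌊ u ≟G a ⌋ ∧ ⌊ v ≟G b ⌋})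

  deleteEdge-adj⁺ : ∀ {u v} → Adj G u v → ¬ (u ≡ a × v ≡ b) → ¬ (u ≡ b × v ≡ a) → Adj (deleteEdge G a b) u v
  deleteEdge-adj⁺ {u} {v} uv ¬ab ¬ba = Equivalence.from T-∧ (uv , Equivalence.from T-not
    ([ ¬ab ∘ both⁻ , ¬ba ∘ both⁻ ]′ ∘ Equivalence.to (T-∨ {⌊ u ≟G a ⌋ ∧ ⌊ v ≟G b ⌋})))

record EdgeGadget (W : Graph) (p q : V W) : Set where
  field
    gadget : Gadget W p q
  open Gadget gadget public
  field
    crosswise-out     : colouring p p′ ≡ colouring q′ q
    crosswise-in      : colouring p′ p ≡ colouring q q′
    inner-enumeration : Enumeration (Inner W p q)
    inner-even        : 2 ∣ Enumeration.size inner-enumeration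
    three-neighbours  : ∀ x → x ≢ p → x ≢ q → Neighbours W x 3

cut-deleteEdge : ∀ {G} → IsSymmetric G → IsIrreflexive G → (z₁ z₂ : V G) → Adj G z₁ z₂ → Cut G (deleteEdge G z₁ z₂)
cut-deleteEdge {G} symmetric irreflexive z₁ z₂ z₁z₂ = record
  { embed = λ a → a ; embed-injective = λ e → e ; embed-adj = λ _ _ → proj₁ ∘ deleteEdge-adj⁻ G z₁ z₂
  ; symmetric = λ a b t → let (ab , ¬12 , ¬21) = deleteEdge-adj⁻ G z₁ z₂ t in
      deleteEdge-adj⁺ G z₁ z₂ (symmetric a b ab) (λ (e , f) → ¬21 (f , e)) (λ (e , f) → ¬12 (f , e))
  ; irreflexive = λ a → irreflexive a ∘ proj₁ ∘ deleteEdge-adj⁻ G z₁ z₂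
  ; z₁ = z₁ ; z₂ = z₂ ; z₁≢z₂ = λ e → irreflexive z₁ (subst (Adj G z₁) (sym e) z₁z₂)
  ; ρ = z₂ ; σ = z₁ ; z₁ρ = z₁z₂ ; z₂σ = symmetric z₁ z₂ z₁z₂
  ; ρ-cut = λ n t e → proj₁ (proj₂ (deleteEdge-adj⁻ G z₁ z₂ t)) (refl , e)
  ; σ-cut = λ n t e → proj₂ (proj₂ (deleteEdge-adj⁻ G z₁ z₂ t)) (refl , e)
  ; lift = lift
  }
  where
  lift : ∀ a n → Adj G a n →
    (a ≡ z₁ × n ≡ z₂) ⊎ (a ≡ z₂ × n ≡ z₁) ⊎ Σ (V G) λ n′ → n′ ≡ n × Adj (deleteEdge G z₁ z₂) a n′
  lift a n t with (_≟_ G) a z₁ ×-dec (_≟_ G) n z₂ | (_≟_ G) a z₂ ×-dec (_≟_ G) n z₁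
  ... | yes e | _ = inj₁ e
  ... | no _ | yes f = inj₂ (inj₁ f)
  ... | no ¬12 | no ¬21 = inj₂ (inj₂ (n , refl , deleteEdge-adj⁺ G z₁ z₂ t ¬12 ¬21))

admissible-replaceEdge : ∀ {G} → Admissible G → (z₁ z₂ : V G) → Adj G z₁ z₂
  → ∀ {W p q} → EdgeGadget W p q → Admissible (glue (deleteEdge G z₁ z₂) z₁ z₂ W p q)
admissible-replaceEdge {G} g z₁ z₂ z₁z₂ {W} {p} {q} gad =
  Glued.admissible′ enumeration inner-enumeration (odd+even odd-order inner-even)
    (inj₁ exceptional) (Glued.old-neighbours exceptional exceptional-neighbour) three
  where
  open Admissible g
  open EdgeGadget gad using (gadget; p′; crosswise-out; crosswise-in; inner-enumeration; inner-even)
  open Gadget gadget using (p-adj; p′≢q) renaming (colouring to cW)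
  p′≢p : p′ ≢ p
  p′≢p e = Gadget.irreflexive gadget p (subst (Adj W p) e p-adj)
  -- The two incidences of the edge z₁z₂, and those of the edge pp′, conflict with each other.
  sending = injection-sending ((cW p p′ , colouring z₁ z₂) ∷ (cW p′ p , colouring z₂ z₁) ∷ [])
    ((≢-sym (ConflictFreeAt.out-in (Gadget.conflictFree gadget p′ p′≢p p′≢q) p p
               (Gadget.symmetric gadget _ _ p-adj) p-adj) ∷ []) ∷ [] ∷ [])
    ((ConflictFreeAt.out-in (conflictFree z₁) z₂ z₂ z₁z₂ (symmetric z₁ z₂ z₁z₂) ∷ []) ∷ [] ∷ [])
  π = proj₁ sending
  sent = All.lookup (proj₂ (proj₂ sending))
  s₀ : π (cW p p′) ≡ colouring z₁ z₂
  s₀ = sent (here refl)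
  s₁ : π (cW p′ p) ≡ colouring z₂ z₁
  s₁ = sent (there (here refl))
  module Glued = Glue g (cut-deleteEdge symmetric irreflexive z₁ z₂ z₁z₂)
    (gadget-recolour gadget π (proj₁ (proj₂ sending)))
    s₀ s₁ (trans (cong π (sym crosswise-in)) s₁) (trans (cong π (sym crosswise-out)) s₀)
  three : ∀ v → v ≢ inj₁ exceptional → Neighbours Glued.G′ v 3
  three (inj₁ a) a≢d = Glued.old-neighbours a (three-neighbours a (a≢d ∘ cong inj₁))
  three (inj₂ x) _ = Glued.inner-neighbours x
    (EdgeGadget.three-neighbours gad (proj₁ x) (Glued.inner-≢p x) (Glued.inner-≢q x))

-- The gadget H t

data HVertex : Set where
  x′ y′ : HVertex
  x y   : ℕ → HVertex

index : ℕ → HVertex → ℕ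
index t x′ = 0
index t y′ = 1
index t (x i) = 2 + i
index t (y i) = 3 + t + i

label : ℕ → ℕ → HVertex
label t 0 = x′
label t 1 = y′
label t (suc (suc k)) with k ℕ.≤? t
... | yes _ = x k
... | no _ = y (k ∸ suc t)

label-x : ∀ t k → k ≤ t → label t (2 + k) ≡ x k
label-x t k k≤t with k ℕ.≤? t
... | yes _ = refl
... | no k≰t = ⊥-elim (k≰t k≤t)

label-y : ∀ t k → label t (3 + t + k) ≡ y k
label-y t k with suc (t + k) ℕ.≤? t
... | yes t+k<t = ⊥-elim (ℕ.m+n≮m t k t+k<t)
... | no _ = cong y (ℕ.m+n∸m≡n t k)

label-injective : ∀ t m n → label t m ≡ label t n → m ≡ n
label-injective t 0 0 e = refl
label-injective t 1 1 e = refl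
label-injective t 0 1 ()
label-injective t 1 0 ()
label-injective t 0 (suc (suc k)) e with k ℕ.≤? t
label-injective t 0 (suc (suc k)) () | yes _
label-injective t 0 (suc (suc k)) () | no _
label-injective t 1 (suc (suc k)) e with k ℕ.≤? t
label-injective t 1 (suc (suc k)) () | yes _
label-injective t 1 (suc (suc k)) () | no _
label-injective t (suc (suc k)) 0 e with k ℕ.≤? t
label-injective t (suc (suc k)) 0 () | yes _
label-injective t (suc (suc k)) 0 () | no _
label-injective t (suc (suc k)) 1 e with k ℕ.≤? t
label-injective t (suc (suc k)) 1 () | yes _
label-injective t (suc (suc k)) 1 () | no _
label-injective t (suc (suc k)) (suc (suc k′)) e with k ℕ.≤? t | k′ ℕ.≤? t
label-injective t (suc (suc k)) (suc (suc k′)) refl | yes _ | yes _ = refl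
label-injective t (suc (suc k)) (suc (suc k′)) () | yes _ | no _
label-injective t (suc (suc k)) (suc (suc k′)) () | no _ | yes _
label-injective t (suc (suc k)) (suc (suc k′)) e | no k≰t | no k′≰t = cong (2 +_) (begin
  k                     ≡⟨ ℕ.m+[n∸m]≡n (ℕ.≰⇒> k≰t) ⟨
  suc t + (k ∸ suc t)   ≡⟨ cong (λ { (y i) → suc t + i ; _ → 0 }) e ⟩
  suc t + (k′ ∸ suc t)  ≡⟨ ℕ.m+[n∸m]≡n (ℕ.≰⇒> k′≰t) ⟩
  k′                    ∎)
  where open ≡-Reasoning

InRange : ℕ → HVertex → Set
InRange t (x i) = i ≤ t
InRange t (y i) = i ≤ t
InRange t _ = ⊤

index<size : ∀ t v → InRange t v → index t v < 4 + t + t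
index<size t x′ _ = s≤s z≤n
index<size t y′ _ = s≤s (s≤s z≤n)
index<size t (x i) i≤t = s≤s (s≤s (s≤s (ℕ.≤-trans i≤t (ℕ.≤-trans (ℕ.m≤m+n t t) (ℕ.n≤1+n _)))))
index<size t (y i) i≤t = s≤s (s≤s (s≤s (s≤s (ℕ.+-monoʳ-≤ t i≤t))))

label-index : ∀ t v → InRange t v → label t (index t v) ≡ v
label-index t x′ _ = refl
label-index t y′ _ = refl
label-index t (x i) i≤t = label-x t i i≤t
label-index t (y i) _ = label-y t i

label-inRange : ∀ t n → n < 4 + t + t → InRange t (label t n)
label-inRange t 0 _ = tt
label-inRange t 1 _ = tt
label-inRange t (suc (suc k)) (s≤s (s≤s k<2+t+t)) with k ℕ.≤? t
... | yes k≤t = k≤t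
... | no _ = subst (k ∸ suc t ≤_) (ℕ.m+n∸m≡n (suc t) t) (ℕ.∸-monoˡ-≤ (suc t) (ℕ.≤-pred k<2+t+t))

data HEdge (t : ℕ) : HVertex → HVertex → Set where
  x′y′ : HEdge t x′ y′
  x′x₀ : HEdge t x′ (x 0)
  x′y₀ : HEdge t x′ (y 0)
  y′x₀ : HEdge t y′ (x 0)
  y′y₀ : HEdge t y′ (y 0)
  xx   : ∀ j → j < t → HEdge t (x j) (x (suc j))
  yy   : ∀ j → j < t → HEdge t (y j) (y (suc j))
  rung : ∀ j → suc j < t → HEdge t (x (suc j)) (y (suc j))

HAdj : ℕ → HVertex → HVertex → Set
HAdj t v u = HEdge t v u ⊎ HEdge t u v

HEdge-inRangeˡ : ∀ {t v u} → HEdge t v u → InRange t v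
HEdge-inRangeˡ x′y′ = tt
HEdge-inRangeˡ x′x₀ = tt
HEdge-inRangeˡ x′y₀ = tt
HEdge-inRangeˡ y′x₀ = tt
HEdge-inRangeˡ y′y₀ = tt
HEdge-inRangeˡ (xx j j<t) = ℕ.<⇒≤ j<t
HEdge-inRangeˡ (yy j j<t) = ℕ.<⇒≤ j<t
HEdge-inRangeˡ (rung j 1+j<t) = ℕ.<⇒≤ 1+j<t

HEdge-inRangeʳ : ∀ {t v u} → HEdge t v u → InRange t u
HEdge-inRangeʳ x′y′ = tt
HEdge-inRangeʳ x′x₀ = z≤n
HEdge-inRangeʳ x′y₀ = z≤n
HEdge-inRangeʳ y′x₀ = z≤n
HEdge-inRangeʳ y′y₀ = z≤n
HEdge-inRangeʳ (xx j j<t) = j<t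
HEdge-inRangeʳ (yy j j<t) = j<t
HEdge-inRangeʳ (rung j 1+j<t) = ℕ.<⇒≤ 1+j<t

module _ (t : ℕ) where

  private
    xs ys rungs : List (ℕ × ℕ)
    xs = applyUpTo (λ j → (2 + j , 3 + j)) t
    ys = applyUpTo (λ j → (3 + t + j , 4 + t + j)) t
    rungs = applyUpTo (λ j → (3 + j , 4 + t + j)) (t ∸ 1)

    label-y₀ : label t (3 + t) ≡ y 0
    label-y₀ = subst (λ n → label t (3 + n) ≡ y 0) (ℕ.+-identityʳ t) (label-y t 0)

    label-y₁₊ : ∀ j → label t (4 + t + j) ≡ y (suc j)
    label-y₁₊ j = subst (λ n → label t (3 + n) ≡ y (suc j)) (ℕ.+-suc t j) (label-y t (suc j))

    later : ∀ {e} → e ∈ xs ++ ys ++ rungs → e ∈ H-edges t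
    later = there ∘ there ∘ there ∘ there ∘ there

  ∈H-edges⇒HEdge : ∀ {A B} → (A , B) ∈ H-edges t → HEdge t (label t A) (label t B)
  ∈H-edges⇒HEdge (here refl) = x′y′
  ∈H-edges⇒HEdge (there (here refl)) = subst (HEdge t x′) (sym (label-x t 0 z≤n)) x′x₀
  ∈H-edges⇒HEdge (there (there (here refl))) = subst (HEdge t x′) (sym label-y₀) x′y₀
  ∈H-edges⇒HEdge (there (there (there (here refl)))) = subst (HEdge t y′) (sym (label-x t 0 z≤n)) y′x₀
  ∈H-edges⇒HEdge (there (there (there (there (here refl))))) = subst (HEdge t y′) (sym label-y₀) y′y₀
  ∈H-edges⇒HEdge (there (there (there (there (there e∈))))) with ∈.∈-++⁻ xs e∈
  ... | inj₁ e∈xs with ∈.∈-applyUpTo⁻ (λ j → (2 + j , 3 + j)) e∈xs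
  ...   | j , j<t , refl = subst₂ (HEdge t) (sym (label-x t j (ℕ.<⇒≤ j<t))) (sym (label-x t (suc j) j<t)) (xx j j<t)
  ∈H-edges⇒HEdge (there (there (there (there (there e∈))))) | inj₂ e∈ys+
    with ∈.∈-++⁻ ys e∈ys+
  ... | inj₁ e∈ys with ∈.∈-applyUpTo⁻ (λ j → (3 + t + j , 4 + t + j)) e∈ys
  ...   | j , j<t , refl = subst₂ (HEdge t) (sym (label-y t j)) (sym (label-y₁₊ j)) (yy j j<t)
  ∈H-edges⇒HEdge (there (there (there (there (there e∈))))) | inj₂ _ | inj₂ e∈rungs
    with ∈.∈-applyUpTo⁻ (λ j → (3 + j , 4 + t + j)) e∈rungs
  ... | j , j<t-1 , refl =
    subst₂ (HEdge t) (sym (label-x t (suc j) (ℕ.<⇒≤ (1+j<n t j<t-1)))) (sym (label-y₁₊ j)) (rung j (1+j<n t j<t-1))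
    where
    1+j<n : ∀ n → j < n ∸ 1 → suc j < n
    1+j<n (suc n) j<n = s≤s j<n

  HEdge⇒∈H-edges : ∀ {v u} → HEdge t v u → (index t v , index t u) ∈ H-edges t
  HEdge⇒∈H-edges x′y′ = here refl
  HEdge⇒∈H-edges x′x₀ = there (here refl)
  HEdge⇒∈H-edges x′y₀ = subst (λ n → (0 , 3 + n) ∈ H-edges t) (sym (ℕ.+-identityʳ t)) (there (there (here refl)))
  HEdge⇒∈H-edges y′x₀ = there (there (there (here refl)))
  HEdge⇒∈H-edges y′y₀ =
    subst (λ n → (1 , 3 + n) ∈ H-edges t) (sym (ℕ.+-identityʳ t)) (there (there (there (there (here refl)))))
  HEdge⇒∈H-edges (xx j j<t) = later (∈.∈-++⁺ˡ (∈.∈-applyUpTo⁺ _ j<t))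
  HEdge⇒∈H-edges (yy j j<t) = subst (λ n → (3 + t + j , 3 + n) ∈ H-edges t) (sym (ℕ.+-suc t j))
    (later (∈.∈-++⁺ʳ xs (∈.∈-++⁺ˡ (∈.∈-applyUpTo⁺ _ j<t))))
  HEdge⇒∈H-edges (rung j 1+j<t) = subst (λ n → (3 + j , 3 + n) ∈ H-edges t) (sym (ℕ.+-suc t j))
    (later (∈.∈-++⁺ʳ xs (∈.∈-++⁺ʳ ys (∈.∈-applyUpTo⁺ _ (j<t-1 t 1+j<t)))))
    where
    j<t-1 : ∀ t → suc j < t → j < t ∸ 1
    j<t-1 (suc t) (s≤s j<t) = j<t

parity : ℕ → Fin 3
parity 0 = # 0
parity 1 = # 1
parity (suc (suc n)) = parity n

parity-≢2 : ∀ n → parity n ≢ # 2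
parity-≢2 0 ()
parity-≢2 1 ()
parity-≢2 (suc (suc n)) = parity-≢2 n

parity-suc : ∀ n → parity (suc n) ≢ parity n
parity-suc 0 ()
parity-suc 1 ()
parity-suc (suc (suc n)) = parity-suc n

-- A proper 3-edge-colouring of H t: the edges at x′ and at y′ use the classes 0, 1, 2, the two
-- paths alternate between 0 and 1, and all rungs get class 2.
edgeClass : HVertex → HVertex → Fin 3
edgeClass x′ y′ = # 0
edgeClass y′ x′ = # 0
edgeClass x′ (x _) = # 1
edgeClass (x _) x′ = # 1
edgeClass y′ (y _) = # 1
edgeClass (y _) y′ = # 1
edgeClass (x i) (x j) = parity (i ⊓ j)
edgeClass (y i) (y j) = parity (i ⊓ j)
edgeClass _ _ = # 2

edgeClass-sym : ∀ v u → edgeClass v u ≡ edgeClass u v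
edgeClass-sym x′ x′ = refl
edgeClass-sym x′ y′ = refl
edgeClass-sym x′ (x _) = refl
edgeClass-sym x′ (y _) = refl
edgeClass-sym y′ x′ = refl
edgeClass-sym y′ y′ = refl
edgeClass-sym y′ (x _) = refl
edgeClass-sym y′ (y _) = refl
edgeClass-sym (x _) x′ = refl
edgeClass-sym (x _) y′ = refl
edgeClass-sym (x i) (x j) = cong parity (ℕ.⊓-comm i j)
edgeClass-sym (x _) (y _) = refl
edgeClass-sym (y _) x′ = refl
edgeClass-sym (y _) y′ = refl
edgeClass-sym (y _) (x _) = refl
edgeClass-sym (y i) (y j) = cong parity (ℕ.⊓-comm i j)

-- The neighbour of v along the edge of class c (meaningful only when v has such an edge).
along : HVertex → Fin 3 → HVertex
along x′ fz = y′
along x′ (fs fz) = x 0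
along x′ (fs (fs fz)) = y 0
along y′ fz = x′
along y′ (fs fz) = y 0
along y′ (fs (fs fz)) = x 0
along (x zero) fz = x 1
along (x zero) (fs fz) = x′
along (x zero) (fs (fs fz)) = y′
along (y zero) fz = y 1
along (y zero) (fs fz) = y′
along (y zero) (fs (fs fz)) = x′
along (x (suc i)) c with c Fin.≟ # 2 | c Fin.≟ parity (suc i)
... | yes _ | _ = y (suc i)
... | no _ | yes _ = x (suc (suc i))
... | no _ | no _ = x i
along (y (suc i)) c with c Fin.≟ # 2 | c Fin.≟ parity (suc i)
... | yes _ | _ = x (suc i)
... | no _ | yes _ = y (suc (suc i))
... | no _ | no _ = y i

module _ (i : ℕ) where

  along-x-forward : along (x (suc i)) (parity (suc i)) ≡ x (suc (suc i))
  along-x-forward with parity (suc i) Fin.≟ # 2 | parity (suc i) Fin.≟ parity (suc i)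
  ... | yes is2 | _ = ⊥-elim (parity-≢2 (suc i) is2)
  ... | no _ | yes _ = refl
  ... | no _ | no ≢ = ⊥-elim (≢ refl)

  along-x-back : along (x (suc i)) (parity i) ≡ x i
  along-x-back with parity i Fin.≟ # 2 | parity i Fin.≟ parity (suc i)
  ... | yes is2 | _ = ⊥-elim (parity-≢2 i is2)
  ... | no _ | yes e = ⊥-elim (parity-suc i (sym e))
  ... | no _ | no _ = refl

  along-y-forward : along (y (suc i)) (parity (suc i)) ≡ y (suc (suc i))
  along-y-forward with parity (suc i) Fin.≟ # 2 | parity (suc i) Fin.≟ parity (suc i)
  ... | yes is2 | _ = ⊥-elim (parity-≢2 (suc i) is2)
  ... | no _ | yes _ = refl
  ... | no _ | no ≢ = ⊥-elim (≢ refl)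

  along-y-back : along (y (suc i)) (parity i) ≡ y i
  along-y-back with parity i Fin.≟ # 2 | parity i Fin.≟ parity (suc i)
  ... | yes is2 | _ = ⊥-elim (parity-≢2 i is2)
  ... | no _ | yes e = ⊥-elim (parity-suc i (sym e))
  ... | no _ | no _ = refl

  i⊓1+i : i ⊓ suc i ≡ i
  i⊓1+i = ℕ.m≤n⇒m⊓n≡m (ℕ.n≤1+n i)

  1+i⊓i : suc i ⊓ i ≡ i
  1+i⊓i = trans (ℕ.⊓-comm (suc i) i) i⊓1+i

along-edgeClass : ∀ {t v u} → HAdj t v u → along v (edgeClass v u) ≡ u
along-edgeClass (inj₁ x′y′) = refl
along-edgeClass (inj₂ x′y′) = refl
along-edgeClass (inj₁ x′x₀) = refl
along-edgeClass (inj₂ x′x₀) = refl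
along-edgeClass (inj₁ x′y₀) = refl
along-edgeClass (inj₂ x′y₀) = refl
along-edgeClass (inj₁ y′x₀) = refl
along-edgeClass (inj₂ y′x₀) = refl
along-edgeClass (inj₁ y′y₀) = refl
along-edgeClass (inj₂ y′y₀) = refl
along-edgeClass (inj₁ (xx zero _)) = refl
along-edgeClass (inj₁ (xx (suc i) _)) rewrite i⊓1+i i = along-x-forward i
along-edgeClass (inj₂ (xx i _)) rewrite 1+i⊓i i = along-x-back i
along-edgeClass (inj₁ (yy zero _)) = refl
along-edgeClass (inj₁ (yy (suc i) _)) rewrite i⊓1+i i = along-y-forward i
along-edgeClass (inj₂ (yy i _)) rewrite 1+i⊓i i = along-y-back i
along-edgeClass (inj₁ (rung _ _)) = refl
along-edgeClass (inj₂ (rung _ _)) = refl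

edgeClass-proper : ∀ {t v u u′} → HAdj t v u → HAdj t v u′ → edgeClass v u ≡ edgeClass v u′ → u ≡ u′
edgeClass-proper {v = v} vu vu′ e = trans (sym (along-edgeClass vu)) (trans (cong (along v) e) (along-edgeClass vu′))

-- Edges point from x′ to y′ to the x-path to the y-path, away from x₀ along the x-path and towards
-- y₀ along the y-path; the latter makes the two terminal edges of H t look alike (see crosswise).
orient : HVertex → HVertex → Bool
orient (x i) (x j) = i <ᵇ j
orient (y i) (y j) = j <ᵇ i
orient v u = rank v <ᵇ rank u
  where
  rank : HVertex → ℕ
  rank x′ = 0
  rank y′ = 1
  rank (x _) = 2
  rank (y _) = 3

<ᵇ-suc : ∀ j → (j <ᵇ suc j) ≢ (suc j <ᵇ j)
<ᵇ-suc zero ()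
<ᵇ-suc (suc j) = <ᵇ-suc j

orient-antisym : ∀ {t v u} → HAdj t v u → orient v u ≢ orient u v
orient-antisym (inj₁ x′y′) ()
orient-antisym (inj₂ x′y′) ()
orient-antisym (inj₁ x′x₀) ()
orient-antisym (inj₂ x′x₀) ()
orient-antisym (inj₁ x′y₀) ()
orient-antisym (inj₂ x′y₀) ()
orient-antisym (inj₁ y′x₀) ()
orient-antisym (inj₂ y′x₀) ()
orient-antisym (inj₁ y′y₀) ()
orient-antisym (inj₂ y′y₀) ()
orient-antisym (inj₁ (xx j _)) = <ᵇ-suc j
orient-antisym (inj₂ (xx j _)) = ≢-sym (<ᵇ-suc j)
orient-antisym (inj₁ (yy j _)) = ≢-sym (<ᵇ-suc j)
orient-antisym (inj₂ (yy j _)) = <ᵇ-suc j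
orient-antisym (inj₁ (rung _ _)) ()
orient-antisym (inj₂ (rung _ _)) ()

HEdge-irreflexive : ∀ {t v} → ¬ HEdge t v v
HEdge-irreflexive ()

record ThreeHNeighbours (t : ℕ) (v : HVertex) : Set where
  field
    u₀ u₁ u₂ : HVertex
    adj₀ : HAdj t v u₀
    adj₁ : HAdj t v u₁
    adj₂ : HAdj t v u₂
    u₀≢u₁ : u₀ ≢ u₁
    u₀≢u₂ : u₀ ≢ u₂
    u₁≢u₂ : u₁ ≢ u₂

threeHNeighbours : ∀ t v → InRange t v → v ≢ x t → v ≢ y t → ThreeHNeighbours t v
threeHNeighbours t x′ _ _ _ = record
  { u₀ = y′ ; u₁ = x 0 ; u₂ = y 0 ; adj₀ = inj₁ x′y′ ; adj₁ = inj₁ x′x₀ ; adj₂ = inj₁ x′y₀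
  ; u₀≢u₁ = λ () ; u₀≢u₂ = λ () ; u₁≢u₂ = λ () }
threeHNeighbours t y′ _ _ _ = record
  { u₀ = x′ ; u₁ = x 0 ; u₂ = y 0 ; adj₀ = inj₂ x′y′ ; adj₁ = inj₁ y′x₀ ; adj₂ = inj₁ y′y₀
  ; u₀≢u₁ = λ () ; u₀≢u₂ = λ () ; u₁≢u₂ = λ () }
threeHNeighbours t (x zero) 0≤t 0≢t _ = record
  { u₀ = x′ ; u₁ = y′ ; u₂ = x 1 ; adj₀ = inj₂ x′x₀ ; adj₁ = inj₂ y′x₀ ; adj₂ = inj₁ (xx 0 (ℕ.≤∧≢⇒< 0≤t (0≢t ∘ cong x)))
  ; u₀≢u₁ = λ () ; u₀≢u₂ = λ () ; u₁≢u₂ = λ () }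
threeHNeighbours t (x (suc i)) i<t i≢t _ = record
  { u₀ = x i ; u₁ = x (suc (suc i)) ; u₂ = y (suc i)
  ; adj₀ = inj₂ (xx i i<t) ; adj₁ = inj₁ (xx (suc i) 1+i<t) ; adj₂ = inj₁ (rung i 1+i<t)
  ; u₀≢u₁ = λ { () } ; u₀≢u₂ = λ () ; u₁≢u₂ = λ () }
  where
  1+i<t : suc i < t
  1+i<t = ℕ.≤∧≢⇒< i<t (i≢t ∘ cong x)
threeHNeighbours t (y zero) 0≤t _ 0≢t = record
  { u₀ = x′ ; u₁ = y′ ; u₂ = y 1 ; adj₀ = inj₂ x′y₀ ; adj₁ = inj₂ y′y₀ ; adj₂ = inj₁ (yy 0 (ℕ.≤∧≢⇒< 0≤t (0≢t ∘ cong y)))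
  ; u₀≢u₁ = λ () ; u₀≢u₂ = λ () ; u₁≢u₂ = λ () }
threeHNeighbours t (y (suc i)) i<t _ i≢t = record
  { u₀ = y i ; u₁ = y (suc (suc i)) ; u₂ = x (suc i)
  ; adj₀ = inj₂ (yy i i<t) ; adj₁ = inj₁ (yy (suc i) 1+i<t) ; adj₂ = inj₂ (rung i 1+i<t)
  ; u₀≢u₁ = λ { () } ; u₀≢u₂ = λ () ; u₁≢u₂ = λ () }
  where
  1+i<t : suc i < t
  1+i<t = ℕ.≤∧≢⇒< i<t (i≢t ∘ cong y)

HAdj-inRange : ∀ {t v u} → HAdj t v u → InRange t u
HAdj-inRange (inj₁ e) = HEdge-inRangeʳ e
HAdj-inRange (inj₂ e) = HEdge-inRangeˡ e

encode : Fin 3 × Bool → Fin 7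
encode (c , b) = inject₁ (combine c (Inverse.from Fin.2↔Bool b))

encode-injective : ∀ {a b} → encode a ≡ encode b → a ≡ b
encode-injective {c , b} {c′ , b′} e with Fin.combine-injective c _ c′ _ (Fin.inject₁-injective e)
... | refl , f = cong (c ,_) (trans (sym (Inverse.strictlyInverseˡ Fin.2↔Bool b))
                         (trans (cong (Inverse.to Fin.2↔Bool) f) (Inverse.strictlyInverseˡ Fin.2↔Bool b′)))

module HGadget (s : ℕ) where

  t = suc s
  W = H t

  private
    N = 4 + t + t

  lab : Fin N → HVertex
  lab a = label t (toℕ a)

  lab-injective : ∀ {a b} → lab a ≡ lab b → a ≡ b
  lab-injective e = Fin.toℕ-injective (label-injective t _ _ e)

  vertexAt : ∀ v → InRange t v → Fin N
  vertexAt v r = fromℕ< (index<size t v r)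

  lab-vertexAt : ∀ v r → lab (vertexAt v r) ≡ v
  lab-vertexAt v r = trans (cong (label t) (Fin.toℕ-fromℕ< (index<size t v r))) (label-index t v r)

  adj⁻ : ∀ a b → Adj W a b → HAdj t (lab a) (lab b)
  adj⁻ a b ab = Sum.map (∈H-edges⇒HEdge t) (∈H-edges⇒HEdge t) (edgeGraph-adj⁻ N (H-edges t) a b ab)

  edge⁺ : ∀ a b → HEdge t (lab a) (lab b) → Adj W a b
  edge⁺ a b e = edgeGraph-adj⁺ N (H-edges t) a b
    (subst₂ (λ m n → (m , n) ∈ H-edges t) (toℕ≡index a (HEdge-inRangeˡ e)) (toℕ≡index b (HEdge-inRangeʳ e))
      (HEdge⇒∈H-edges t e))
    where
    toℕ≡index : ∀ a → InRange t (lab a) → index t (lab a) ≡ toℕ a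
    toℕ≡index a r = label-injective t _ _ (label-index t (lab a) r)

  adj⁺ : ∀ a b → HAdj t (lab a) (lab b) → Adj W a b
  adj⁺ a b (inj₁ e) = edge⁺ a b e
  adj⁺ a b (inj₂ e) = edgeGraph-symmetric N (H-edges t) b a (edge⁺ b a e)

  colourOf : HVertex → HVertex → Fin 7
  colourOf v u = encode (edgeClass v u , orient v u)

  colouring : Fin N → Fin N → Fin 7
  colouring a b = colourOf (lab a) (lab b)

  conflictFree : ∀ w → ConflictFreeAt W colouring w
  conflictFree w = conflictFreeAt-relabel W _ encode encode-injective w
    (edgeColouring⇒conflictFreeAt W (λ a b → edgeClass (lab a) (lab b)) (λ a b → orient (lab a) (lab b))
      (edgeGraph-symmetric N (H-edges t)) (λ a b → edgeClass-sym (lab a) (lab b)) w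
      (λ u u′ wu wu′ e → lab-injective (edgeClass-proper (adj⁻ w u wu) (adj⁻ w u′ wu′) e))
      (λ u wu → orient-antisym (adj⁻ w u wu)))

  p q p′ q′ : Fin N
  p = H-xt t
  q = H-yt t
  p′ = vertexAt (x s) (ℕ.n≤1+n s)
  q′ = vertexAt (y s) (ℕ.n≤1+n s)

  lab-p : lab p ≡ x t
  lab-p = lab-vertexAt (x t) ℕ.≤-refl

  lab-q : lab q ≡ y t
  lab-q = trans (cong (label t) (Fin.toℕ-fromℕ< (ℕ.n<1+n (3 + t + t)))) (label-y t t)

  lab-p′ : lab p′ ≡ x s
  lab-p′ = lab-vertexAt (x s) (ℕ.n≤1+n s)

  lab-q′ : lab q′ ≡ y s
  lab-q′ = lab-vertexAt (y s) (ℕ.n≤1+n s)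

  x-leaf : ∀ {u} → HAdj t (x t) u → u ≡ x s
  x-leaf (inj₁ (xx _ t<t)) = ⊥-elim (ℕ.n≮n _ t<t)
  x-leaf (inj₁ (rung _ t<t)) = ⊥-elim (ℕ.n≮n _ t<t)
  x-leaf (inj₂ (xx _ _)) = refl

  y-leaf : ∀ {u} → HAdj t (y t) u → u ≡ y s
  y-leaf (inj₁ (yy _ t<t)) = ⊥-elim (ℕ.n≮n _ t<t)
  y-leaf (inj₂ (yy _ _)) = refl
  y-leaf (inj₂ (rung _ t<t)) = ⊥-elim (ℕ.n≮n _ t<t)

  gadget : Gadget W p q
  gadget = record
    { p≢q = λ e → x≢y (trans (sym lab-p) (trans (cong lab e) lab-q))
    ; symmetric = edgeGraph-symmetric N (H-edges t)
    ; irreflexive = λ a aa → [ HEdge-irreflexive , HEdge-irreflexive ]′ (adj⁻ a a aa)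
    ; p′ = p′ ; q′ = q′
    ; p-adj = adj⁺ p p′ (subst₂ (HAdj t) (sym lab-p) (sym lab-p′) (inj₂ (xx s ℕ.≤-refl)))
    ; q-adj = adj⁺ q q′ (subst₂ (HAdj t) (sym lab-q) (sym lab-q′) (inj₂ (yy s ℕ.≤-refl)))
    ; p-leaf = λ b pb → lab-injective (trans (x-leaf (subst (λ v → HAdj t v (lab b)) lab-p (adj⁻ p b pb))) (sym lab-p′))
    ; q-leaf = λ b qb → lab-injective (trans (y-leaf (subst (λ v → HAdj t v (lab b)) lab-q (adj⁻ q b qb))) (sym lab-q′))
    ; p′≢q = λ e → x≢y (trans (sym lab-p′) (trans (cong lab e) lab-q))
    ; q′≢p = λ e → x≢y (trans (sym lab-p) (trans (cong lab (sym e)) lab-q′))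
    ; colouring = colouring
    ; conflictFree = λ w _ _ → conflictFree w
    }
    where
    x≢y : ∀ {i j} → x i ≢ y j
    x≢y ()

  crosswise-out : colouring p p′ ≡ colouring q′ q
  crosswise-out = begin
    colouring p p′        ≡⟨ cong₂ colourOf lab-p lab-p′ ⟩
    colourOf (x t) (x s)  ≡⟨ cong (λ m → encode (parity m , (suc s <ᵇ s))) (ℕ.⊓-comm t s) ⟩
    colourOf (y s) (y t)  ≡⟨ cong₂ colourOf lab-q′ lab-q ⟨
    colouring q′ q        ∎
    where open ≡-Reasoning

  crosswise-in : colouring p′ p ≡ colouring q q′
  crosswise-in = begin
    colouring p′ p        ≡⟨ cong₂ colourOf lab-p′ lab-p ⟩
    colourOf (x s) (x t)  ≡⟨ cong (λ m → encode (parity m , (s <ᵇ suc s))) (ℕ.⊓-comm s t) ⟩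
    colourOf (y t) (y s)  ≡⟨ cong₂ colourOf lab-q lab-q′ ⟨
    colouring q q′        ∎
    where open ≡-Reasoning

  inner : Enumeration (Inner W p q)
  inner = subtypeEnumeration _ (allFinEnumeration N)

  inner-even : 2 ∣ Enumeration.size inner
  inner-even = subst (2 ∣_) (sym size≡) (∣m∣n⇒∣m+n (∣-refl {2}) (divides t t+t≡t*2))
    where
    size≡ : Enumeration.size inner ≡ 2 + (t + t)
    size≡ = ℕ.suc-injective (ℕ.suc-injective
      (trans (size-Inner W p q (Gadget.p≢q gadget) (allFinEnumeration N)) (List.length-tabulate (λ a → a))))
    t+t≡t*2 : t + t ≡ t * 2
    t+t≡t*2 = sym (trans (ℕ.*-comm t 2) (cong (t +_) (ℕ.+-identityʳ t)))

  three-neighbours : ∀ a → a ≢ p → a ≢ q → Neighbours W a 3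
  three-neighbours a a≢p a≢q = neighbours₃ W (at u₀ adj₀) (at u₁ adj₁) (at u₂ adj₂)
    (adj-at u₀ adj₀) (adj-at u₁ adj₁) (adj-at u₂ adj₂)
    (distinct u₀≢u₁ adj₀ adj₁) (distinct u₀≢u₂ adj₀ adj₂) (distinct u₁≢u₂ adj₁ adj₂)
    where
    open ThreeHNeighbours (threeHNeighbours t (lab a) (label-inRange t (toℕ a) (Fin.toℕ<n a))
      (λ e → a≢p (lab-injective (trans e (sym lab-p)))) (λ e → a≢q (lab-injective (trans e (sym lab-q)))))
    at : ∀ u → HAdj t (lab a) u → Fin N
    at u au = vertexAt u (HAdj-inRange au)
    adj-at : ∀ u au → Adj W a (at u au)
    adj-at u au = adj⁺ a (at u au) (subst (HAdj t (lab a)) (sym (lab-vertexAt u (HAdj-inRange au))) au)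
    distinct : ∀ {u u′} → u ≢ u′ → ∀ au au′ → at u au ≢ at u′ au′
    distinct {u} {u′} u≢u′ au au′ e =
      u≢u′ (trans (sym (lab-vertexAt u (HAdj-inRange au))) (trans (cong lab e) (lab-vertexAt u′ (HAdj-inRange au′))))

edgeGadget-H : ∀ t → 1 ≤ t → EdgeGadget (H t) (H-xt t) (H-yt t)
edgeGadget-H (suc s) _ = record
  { gadget = gadget
  ; crosswise-out = crosswise-out
  ; crosswise-in = crosswise-in
  ; inner-enumeration = inner
  ; inner-even = inner-even
  ; three-neighbours = three-neighbours
  }
  where open HGadget s

admissible : ∀ {G} → InP G → Admissible G
admissible base = admissible-K4⁺
admissible (iso G∈P G≅H) = admissible-≅ (admissible G∈P) G≅H
admissible (op₂ G∈P z z₁ z₂ d h₁ h₂) = admissible-replaceDeg2 (admissible G∈P) z z₁ z₂ d h₁ h₂ G₂-gadget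
admissible (op₄ G∈P z z₁ z₂ d h₁ h₂) = admissible-replaceDeg2 (admissible G∈P) z z₁ z₂ d h₁ h₂ G₄-gadget
admissible (op₈ G∈P z z₁ z₂ d h₁ h₂) = admissible-replaceDeg2 (admissible G∈P) z z₁ z₂ d h₁ h₂ G₈-gadget
admissible (opH G∈P z₁ z₂ z₁z₂ t 1≤t) = admissible-replaceEdge (admissible G∈P) z₁ z₂ z₁z₂ (edgeGadget-H t 1≤t)

proposition3p12 : ∀ (G : Graph) → InP G → χic≡ G 7
proposition3p12 G G∈P = admissible⇒χic≡7 (admissible G∈P)
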